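{- Let $t_1,t_2,\ldots$ and $s_1,s_2,\ldots$ be commuting indeterminates, and let $$M(x,y;\mathbf{t};\mathbf{s})=\sum_{m,k\geq 0}x^m y^k\sum_{P\in\mathscr{M}_{2m+k}^{m,k}}\prod_{i\geq1}t_i^{u_i(P)}\prod_{i\geq1}s_i^{h_i(P)}.$$ Put $T(x)=1+\sum_{i\geq1}t_ix^i$, $S(y)=1+\sum_{i\geq1}s_iy^i$ and $z=xM(x,y;\mathbf{t};\mathbf{s})$. Then, as formal power series, $$M(x,y;\mathbf{t};\mathbf{s})=\frac{T(z)}{1-\frac{S(y)-1}{S(y)}\,T(z)}.$$
   Context: A Motzkin path of length $n$ is a lattice path from $(0,0)$ to $(n,0)$ in $\mathbb{Z}\times\mathbb{Z}$ consisting of up-steps $u=(1,1)$, horizontal steps $h=(1,0)$ and down-steps $d=(1,-1)$, which never passes below the $x$-axis. $\mathscr{M}_n^{m,k}$ denotes the set of Motzkin paths of length $n=2m+k$ with $m$ up-steps and $k$ horizontal steps. A $u$-segment (resp. $h$-segment) of a Motzkin path $P$ is a maximal sequence of consecutive up-steps (resp. horizontal steps) in $P$; $u_i(P)$ (resp. $h_i(P)$) is the number of $u$-segments (resp. $h$-segments) of length $i$ in $P$. -}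

module Defs where

open import Level using (Level)
open import Algebra.Bundles using (CommutativeRing)
open import Data.Nat using (ℕ; zero; suc; _∸_) renaming (_+_ to _+ℕ_; _*_ to _*ℕ_)
open import Data.Nat.Properties using () renaming (_≟_ to _≟ℕ_)
open import Data.Bool using (Bool; true; false; _∧_; if_then_else_)
open import Data.List using (List; []; _∷_; [_]; length; filter; concatMap; foldr)
open import Data.Product using (_×_; _,_)
open import Relation.Nullary using (Dec; yes; no)
open import Relation.Nullary.Decidable using (⌊_⌋)
open import Relation.Binary.PropositionalEquality using (_≡_; refl)

-- Motzkin paths as words in the steps u, h, d

data Step : Set where
  U H D : Step

_≟S_ : (a b : Step) → Dec (a ≡ b)
U ≟S U = yes refl
U ≟S H = no λ ()
U ≟S D = no λ ()
H ≟S U = no λ ()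
H ≟S H = yes refl
H ≟S D = no λ ()
D ≟S U = no λ ()
D ≟S H = no λ ()
D ≟S D = yes refl

words : ℕ → List (List Step)
words zero    = [] ∷ []
words (suc n) = concatMap (λ w → (U ∷ w) ∷ (H ∷ w) ∷ (D ∷ w) ∷ []) (words n)

validFrom : ℕ → List Step → Bool
validFrom h       []      = ⌊ h ≟ℕ 0 ⌋
validFrom h       (U ∷ w) = validFrom (suc h) w
validFrom h       (H ∷ w) = validFrom h w
validFrom zero    (D ∷ w) = false
validFrom (suc h) (D ∷ w) = validFrom h w

isMotzkin : List Step → Bool
isMotzkin = validFrom 0

count : Step → List Step → ℕ
count a []      = 0
count a (b ∷ w) = if ⌊ a ≟S b ⌋ then suc (count a w) else count a w

-- the set M_n^{m,k} (n = 2m+k), enumerated as a list of words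
motzkinSet : ℕ → ℕ → List (List Step)
motzkinSet m k =
  filter (λ P → T? (isMotzkin P ∧ ⌊ count U P ≟ℕ m ⌋ ∧ ⌊ count H P ≟ℕ k ⌋))
         (words (2 *ℕ m +ℕ k))
  where
  open import Data.Bool.Properties using (T?)
  open import Data.Bool using (T)

-- maximal segments (runs): list of (step, length of the run), lengths ≥ 1
runs : List Step → List (Step × ℕ)
runs []      = []
runs (a ∷ w) = push (runs w)
  where
  push : List (Step × ℕ) → List (Step × ℕ)
  push []              = (a , 1) ∷ []
  push ((b , n) ∷ r) with a ≟S b
  ... | yes _ = (b , suc n) ∷ r
  ... | no  _ = (a , 1) ∷ (b , n) ∷ r

-- number of a-segments of length i in P  (u_i(P) for a = U, h_i(P) for a = H)
segCount : Step → ℕ → List Step → ℕ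
segCount a i P = go (runs P)
  where
  go : List (Step × ℕ) → ℕ
  go []              = 0
  go ((b , n) ∷ r)   = if ⌊ a ≟S b ⌋ ∧ ⌊ i ≟ℕ n ⌋ then suc (go r) else go r

module Series {c ℓ : Level} (R : CommutativeRing c ℓ) where
  open CommutativeRing R

  sumBelow : ℕ → (ℕ → Carrier) → Carrier
  sumBelow zero    f = 0#
  sumBelow (suc n) f = sumBelow n f + f n

  sumTo : ℕ → (ℕ → Carrier) → Carrier
  sumTo n = sumBelow (suc n)

  sumList : List Carrier → Carrier
  sumList = foldr _+_ 0#

  pow : Carrier → ℕ → Carrier
  pow a zero    = 1#
  pow a (suc n) = a * pow a n

  prod1To : ℕ → (ℕ → Carrier) → Carrier
  prod1To zero    f = 1#
  prod1To (suc n) f = prod1To n f * f (suc n)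

  -- a bivariate power series: coefficient of x^m y^k
  Ser : Set c
  Ser = ℕ → ℕ → Carrier

  oneS : Ser
  oneS zero zero    = 1#
  oneS zero (suc k) = 0#
  oneS (suc m) k    = 0#

  _+S_ : Ser → Ser → Ser
  (f +S g) m k = f m k + g m k

  _-S_ : Ser → Ser → Ser
  (f -S g) m k = f m k - g m k

  _*S_ : Ser → Ser → Ser
  (f *S g) m k = sumTo m λ i → sumTo k λ j → f i j * g (m ∸ i) (k ∸ j)

  _^S_ : Ser → ℕ → Ser
  f ^S zero  = oneS
  f ^S suc n = f *S (f ^S n)

  -- multiplicative inverse of a series with constant term 1:
  -- 1/f = Σ_j (1 - f)^j  (only j ≤ m+k contribute to x^m y^k)
  invS : Ser → Ser
  invS f m k = sumTo (m +ℕ k) λ j → ((oneS -S f) ^S j) m k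

  -- composition A(g) = Σ_i a_i g^i for g with zero constant term
  -- (only i ≤ m+k contribute to x^m y^k)
  compose : (ℕ → Carrier) → Ser → Ser
  compose a g m k = sumTo (m +ℕ k) λ i → a i * (g ^S i) m k

  -- The data of Proposition 2.1, for values t s : ℕ → Carrier of the
  -- indeterminates t_1, t_2, ... and s_1, s_2, ... (index 0 unused).

  module _ (t s : ℕ → Carrier) where

    -- Π_i t_i^{u_i(P)} Π_i s_i^{h_i(P)}  (segments have length ≤ |P|)
    weight : List Step → Carrier
    weight P = prod1To (length P) (λ i → pow (t i) (segCount U i P))
             * prod1To (length P) (λ i → pow (s i) (segCount H i P))

    Mser : Ser
    Mser m k = sumList (Data.List.map weight (motzkinSet m k))

    Tcoef : ℕ → Carrier
    Tcoef zero    = 1#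
    Tcoef (suc i) = t (suc i)

    Sser : Ser
    Sser zero zero    = 1#
    Sser zero (suc k) = s (suc k)
    Sser (suc m) k    = 0#

    zser : Ser
    zser zero    k = 0#
    zser (suc m) k = Mser m k

    Tz : Ser
    Tz = compose Tcoef zser

    rhs : Ser
    rhs = Tz *S invS (oneS -S (((Sser -S oneS) *S invS Sser) *S Tz))

module Submission where

-- Idea (a first-step / first-return decomposition of Motzkin paths).
-- Write M = 1 + U + H, where U (resp. H) collects the nonempty paths
-- starting with an up-step (resp. a horizontal step), and let N_U, N_H be
-- the series of paths not starting with u, resp. with h; so N_U = 1 + H and
-- N_H = 1 + U.  Cutting off the leading h-run gives H = (S(y) - 1) N_H.
-- A leading u-run of length l is completed by l descents to height 0;
-- cutting at these first descents shows that paths from height l with no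
-- leading u have series N_U M^l, so U = Σ_l t_l x^l M^l N_U = (T(z) - 1) N_U.
-- Eliminating U, H, N_U, N_H from these four equations in any commutative
-- ring gives M (1 - ((S - 1)/S) T(z)) = T(z), and the claim follows because
-- the series in parentheses has constant term 1, hence is invertible.

open import Defs
open import Level using (Level)
open import Algebra.Bundles using (CommutativeRing)
open import Data.Nat using (ℕ; zero; suc; _∸_; _<_; _≤_; z≤n; s≤s; _≡ᵇ_)
  renaming (_+_ to _+ℕ_; _*_ to _*ℕ_)
import Data.Nat.Properties as ℕₚ
open import Data.Nat.Properties
  using (≤-refl; ≤-trans; ≤-pred; <-trans; n<1+n; m≤m+n; m≤n+m; m∸n≤m; +-suc; m+n∸m≡n; m+[n∸m]≡n;
         +-∸-assoc; n∸n≡0; m≤n⇒m≤1+n)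
  renaming (_≟_ to _≟ℕ_)
open import Data.Bool using (Bool; true; false; _∧_; not; if_then_else_)
import Data.Bool.Properties as Boolₚ
open import Data.List using (List; []; _∷_; _++_; length; map; filter; concatMap; replicate)
open import Data.Product using (_×_; _,_)
open import Data.Unit using (⊤; tt)
open import Data.Empty using (⊥; ⊥-elim)
open import Data.Sum using (inj₁; inj₂)
open import Relation.Binary.PropositionalEquality as ≡ using (_≡_; _≢_)
open import Relation.Nullary using (yes; no)
open import Relation.Nullary.Decidable using (⌊_⌋)
open import Data.Nat.Tactic.RingSolver using (solve-∀)
import Algebra.Solver.CommutativeMonoid as CMSolver
import Algebra.Properties.Ring as RingProperties
import Relation.Binary.Reasoning.Setoid as SetoidReasoning

module FiniteSums {a b : Level} (A : CommutativeRing a b) where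
  open CommutativeRing A
  open Series A
  open SetoidReasoning setoid

  ≡⇒≈ : ∀ {x y} → x ≡ y → x ≈ y
  ≡⇒≈ ≡.refl = refl

  +-interchange : ∀ w x y z → (w + x) + (y + z) ≈ (w + y) + (x + z)
  +-interchange w x y z = begin
    (w + x) + (y + z) ≈⟨ +-assoc w x (y + z) ⟩
    w + (x + (y + z)) ≈⟨ +-congˡ (sym (+-assoc x y z)) ⟩
    w + ((x + y) + z) ≈⟨ +-congˡ (+-congʳ (+-comm x y)) ⟩
    w + ((y + x) + z) ≈⟨ +-congˡ (+-assoc y x z) ⟩
    w + (y + (x + z)) ≈⟨ sym (+-assoc w y (x + z)) ⟩
    (w + y) + (x + z) ∎

  sum-cong-< : ∀ n {f g : ℕ → Carrier} → (∀ i → i < n → f i ≈ g i) → sumBelow n f ≈ sumBelow n g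
  sum-cong-< zero    eq = refl
  sum-cong-< (suc n) eq = +-cong (sum-cong-< n (λ i p → eq i (<-trans p (n<1+n n)))) (eq n (n<1+n n))

  sum-cong : ∀ n {f g : ℕ → Carrier} → (∀ i → f i ≈ g i) → sumBelow n f ≈ sumBelow n g
  sum-cong n eq = sum-cong-< n (λ i _ → eq i)

  sum-+ : ∀ n (f g : ℕ → Carrier) → sumBelow n (λ i → f i + g i) ≈ sumBelow n f + sumBelow n g
  sum-+ zero    f g = sym (+-identityˡ 0#)
  sum-+ (suc n) f g = begin
    sumBelow n (λ i → f i + g i) + (f n + g n)  ≈⟨ +-congʳ (sum-+ n f g) ⟩
    (sumBelow n f + sumBelow n g) + (f n + g n) ≈⟨ +-interchange _ _ _ _ ⟩
    (sumBelow n f + f n) + (sumBelow n g + g n) ∎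

  sum-*ˡ : ∀ n c (f : ℕ → Carrier) → c * sumBelow n f ≈ sumBelow n (λ i → c * f i)
  sum-*ˡ zero    c f = zeroʳ c
  sum-*ˡ (suc n) c f = trans (distribˡ c _ _) (+-congʳ (sum-*ˡ n c f))

  sum-*ʳ : ∀ n c (f : ℕ → Carrier) → sumBelow n f * c ≈ sumBelow n (λ i → f i * c)
  sum-*ʳ zero    c f = zeroˡ c
  sum-*ʳ (suc n) c f = trans (distribʳ c _ _) (+-congʳ (sum-*ʳ n c f))

  sum-zero : ∀ n {f : ℕ → Carrier} → (∀ i → i < n → f i ≈ 0#) → sumBelow n f ≈ 0#
  sum-zero zero    eq = refl
  sum-zero (suc n) eq =
    trans (+-cong (sum-zero n (λ i p → eq i (<-trans p (n<1+n n)))) (eq n (n<1+n n))) (+-identityˡ 0#)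

  sum-front : ∀ n (f : ℕ → Carrier) → sumBelow (suc n) f ≈ f 0 + sumBelow n (λ i → f (suc i))
  sum-front zero    f = trans (+-identityˡ (f 0)) (sym (+-identityʳ (f 0)))
  sum-front (suc n) f = begin
    sumBelow (suc n) f + f (suc n)                     ≈⟨ +-congʳ (sum-front n f) ⟩
    (f 0 + sumBelow n (λ i → f (suc i))) + f (suc n)  ≈⟨ +-assoc _ _ _ ⟩
    f 0 + (sumBelow n (λ i → f (suc i)) + f (suc n))  ∎

  sum-swap : ∀ n m (f : ℕ → ℕ → Carrier) →
    sumBelow n (λ i → sumBelow m (λ j → f i j)) ≈ sumBelow m (λ j → sumBelow n (λ i → f i j))
  sum-swap zero    m f = sym (sum-zero m (λ _ _ → refl))
  sum-swap (suc n) m f = begin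
    sumBelow n (λ i → sumBelow m (λ j → f i j)) + sumBelow m (λ j → f n j)
      ≈⟨ +-congʳ (sum-swap n m f) ⟩
    sumBelow m (λ j → sumBelow n (λ i → f i j)) + sumBelow m (λ j → f n j)
      ≈⟨ sym (sum-+ m _ _) ⟩
    sumBelow m (λ j → sumBelow n (λ i → f i j) + f n j) ∎

  sum-single : ∀ n i₀ {f : ℕ → Carrier} → i₀ < n → (∀ i → i < n → i ≢ i₀ → f i ≈ 0#) →
    sumBelow n f ≈ f i₀
  sum-single zero    i₀ () _
  sum-single (suc n) i₀ {f} i₀<1+n eq with n ≟ℕ i₀
  ... | yes ≡.refl =
    trans (+-congʳ (sum-zero n (λ i i<n → eq i (<-trans i<n (n<1+n n)) (ℕₚ.<⇒≢ i<n)))) (+-identityˡ _)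
  ... | no n≢i₀ = begin
    sumBelow n f + f n ≈⟨ +-congˡ (eq n (n<1+n n) n≢i₀) ⟩
    sumBelow n f + 0#  ≈⟨ +-identityʳ _ ⟩
    sumBelow n f       ≈⟨ sum-single n i₀ i₀<n (λ i i<n → eq i (<-trans i<n (n<1+n n))) ⟩
    f i₀               ∎
    where
    i₀<n : i₀ < n
    i₀<n = ℕₚ.≤∧≢⇒< (≤-pred i₀<1+n) (λ e → n≢i₀ (≡.sym e))

  sum-extend : ∀ k n {f : ℕ → Carrier} → k ≤ n → (∀ i → k ≤ i → i < n → f i ≈ 0#) →
    sumBelow n f ≈ sumBelow k f
  sum-extend k zero    z≤n _  = refl
  sum-extend k (suc n) k≤1+n eq with ℕₚ.m≤n⇒m<n∨m≡n k≤1+n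
  ... | inj₂ ≡.refl = refl
  ... | inj₁ (s≤s k≤n) =
    trans (+-cong (sum-extend k n k≤n (λ i p q → eq i p (<-trans q (n<1+n n)))) (eq n k≤n (n<1+n n)))
          (+-identityʳ _)

  sum-rev : ∀ n (f : ℕ → Carrier) → sumBelow n f ≈ sumBelow n (λ i → f (n ∸ suc i))
  sum-rev zero    f = refl
  sum-rev (suc n) f = begin
    sumBelow n f + f n                        ≈⟨ +-congʳ (sum-rev n f) ⟩
    sumBelow n (λ i → f (n ∸ suc i)) + f n   ≈⟨ +-comm _ _ ⟩
    f n + sumBelow n (λ i → f (n ∸ suc i))   ≈⟨ sym (sum-front n (λ i → f (suc n ∸ suc i))) ⟩
    sumBelow (suc n) (λ i → f (suc n ∸ suc i)) ∎

-- Applied twice this yields the ring of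
-- bivariate series in which all series identities below are proved.
module PowerSeries {a b : Level} (A : CommutativeRing a b) where
  open CommutativeRing A
  open Series A using (sumBelow; sumTo)
  open FiniteSums A
  open SetoidReasoning setoid

  PSer : Set a
  PSer = ℕ → Carrier

  infix  4 _≈P_
  infixl 6 _+P_
  infixl 7 _*P_

  _≈P_ : PSer → PSer → Set b
  f ≈P g = ∀ n → f n ≈ g n

  _+P_ : PSer → PSer → PSer
  (f +P g) n = f n + g n

  -P_ : PSer → PSer
  (-P f) n = - f n

  0P : PSer
  0P _ = 0#

  1P : PSer
  1P zero    = 1#
  1P (suc n) = 0#

  _*P_ : PSer → PSer → PSer
  (f *P g) n = sumTo n (λ i → f i * g (n ∸ i))

  *P-cong : ∀ {f f′ g g′} → f ≈P f′ → g ≈P g′ → f *P g ≈P f′ *P g′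
  *P-cong f≈ g≈ n = sum-cong (suc n) (λ i → *-cong (f≈ i) (g≈ (n ∸ i)))

  *P-comm : ∀ f g → f *P g ≈P g *P f
  *P-comm f g n = begin
    sumTo n (λ i → f i * g (n ∸ i))               ≈⟨ sum-rev (suc n) _ ⟩
    sumTo n (λ i → f (n ∸ i) * g (n ∸ (n ∸ i)))   ≈⟨ sum-cong-< (suc n) swap ⟩
    sumTo n (λ i → g i * f (n ∸ i))               ∎
    where
    swap : ∀ i → i < suc n → f (n ∸ i) * g (n ∸ (n ∸ i)) ≈ g i * f (n ∸ i)
    swap i (s≤s i≤n) rewrite ℕₚ.m∸[m∸n]≡n i≤n = *-comm _ _

  *P-identityˡ : ∀ f → 1P *P f ≈P f
  *P-identityˡ f n = begin
    sumTo n (λ i → 1P i * f (n ∸ i))                       ≈⟨ sum-front n _ ⟩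
    1# * f n + sumBelow n (λ i → 0# * f (n ∸ suc i))      ≈⟨ +-cong (*-identityˡ _) (sum-zero n (λ i _ → zeroˡ _)) ⟩
    f n + 0#                                                ≈⟨ +-identityʳ _ ⟩
    f n                                                     ∎

  *P-distribʳ : ∀ h f g → (f +P g) *P h ≈P f *P h +P g *P h
  *P-distribʳ h f g n = trans (sum-cong (suc n) (λ i → distribʳ _ _ _)) (sum-+ (suc n) _ _)

  *P-scale : ∀ c f h → (λ i → c * f i) *P h ≈P (λ n → c * (f *P h) n)
  *P-scale c f h n = trans (sum-cong (suc n) (λ i → *-assoc _ _ _)) (sym (sum-*ˡ (suc n) c _))

  -- The recursion (f g)_{n+1} = f_0 g_{n+1} + ((f - f_0)/X · g)_n drives associativity.
  *P-suc : ∀ f g n → (f *P g) (suc n) ≈ f 0 * g (suc n) + ((λ i → f (suc i)) *P g) n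
  *P-suc f g n = sum-front (suc n) _

  *P-assoc : ∀ f g h → (f *P g) *P h ≈P f *P (g *P h)
  *P-assoc f g h n = go n f
    where
    go : ∀ n f → ((f *P g) *P h) n ≈ (f *P (g *P h)) n
    go zero f = begin
      0# + (0# + f 0 * g 0) * h 0   ≈⟨ +-congˡ (*-congʳ (+-identityˡ _)) ⟩
      0# + (f 0 * g 0) * h 0        ≈⟨ +-congˡ (*-assoc _ _ _) ⟩
      0# + f 0 * (g 0 * h 0)        ≈⟨ +-congˡ (*-congˡ (sym (+-identityˡ _))) ⟩
      0# + f 0 * (0# + g 0 * h 0)   ∎
    go (suc n) f = begin
      ((f *P g) *P h) (suc n)
        ≈⟨ *P-suc (f *P g) h n ⟩
      (f *P g) 0 * h (suc n) + ((λ i → (f *P g) (suc i)) *P h) n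
        ≈⟨ +-cong (*-congʳ (+-identityˡ _)) (*P-cong {g = h} {g′ = h} (λ i → *P-suc f g i) (λ _ → refl) n) ⟩
      (f 0 * g 0) * h (suc n) + ((λ i → f 0 * g (suc i) + (f′ *P g) i) *P h) n
        ≈⟨ +-cong (*-assoc _ _ _) (*P-distribʳ h _ _ n) ⟩
      f 0 * (g 0 * h (suc n)) + (((λ i → f 0 * g (suc i)) *P h) n + ((f′ *P g) *P h) n)
        ≈⟨ +-congˡ (+-cong (*P-scale (f 0) _ h n) (go n f′)) ⟩
      f 0 * (g 0 * h (suc n)) + (f 0 * (g′ *P h) n + (f′ *P (g *P h)) n)
        ≈⟨ sym (+-assoc _ _ _) ⟩
      (f 0 * (g 0 * h (suc n)) + f 0 * (g′ *P h) n) + (f′ *P (g *P h)) n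
        ≈⟨ +-congʳ (sym (distribˡ _ _ _)) ⟩
      f 0 * (g 0 * h (suc n) + (g′ *P h) n) + (f′ *P (g *P h)) n
        ≈⟨ +-congʳ (*-congˡ (sym (*P-suc g h n))) ⟩
      f 0 * (g *P h) (suc n) + (f′ *P (g *P h)) n
        ≈⟨ sym (*P-suc f (g *P h) n) ⟩
      (f *P (g *P h)) (suc n) ∎
      where
      f′ g′ : PSer
      f′ i = f (suc i)
      g′ i = g (suc i)

  PSRing : CommutativeRing a b
  PSRing = record
    { Carrier = PSer
    ; _≈_ = _≈P_
    ; _+_ = _+P_
    ; _*_ = _*P_
    ; -_ = -P_
    ; 0# = 0P
    ; 1# = 1P
    ; isCommutativeRing = record
      { isRing = record
        { +-isAbelianGroup = record
          { isGroup = record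
            { isMonoid = record
              { isSemigroup = record
                { isMagma = record
                  { isEquivalence = record
                    { refl = λ n → refl ; sym = λ p n → sym (p n) ; trans = λ p q n → trans (p n) (q n) }
                  ; ∙-cong = λ p q n → +-cong (p n) (q n) }
                ; assoc = λ f g h n → +-assoc (f n) (g n) (h n) }
              ; identity = (λ f n → +-identityˡ (f n)) , (λ f n → +-identityʳ (f n)) }
            ; inverse = (λ f n → -‿inverseˡ (f n)) , (λ f n → -‿inverseʳ (f n))
            ; ⁻¹-cong = λ p n → -‿cong (p n) }
          ; comm = λ f g n → +-comm (f n) (g n) }
        ; *-cong = *P-cong
        ; *-assoc = *P-assoc
        ; *-identity = *P-identityˡ , (λ f n → trans (*P-comm f 1P n) (*P-identityˡ f n))
        ; distrib = (λ h f g n → trans (*P-comm h (f +P g) n)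
                                   (trans (*P-distribʳ h f g n) (+-cong (*P-comm f h n) (*P-comm g h n))))
                  , *P-distribʳ }
      ; *-comm = *P-comm }
    }

module Geometric {a b : Level} (C : CommutativeRing a b) where
  open CommutativeRing C
  open Series C using (sumTo; sumBelow; pow)
  open RingProperties ring using (-‿+-comm; -‿involutive; -‿distribˡ-*)
  open SetoidReasoning setoid

  one-minus-one-minus : ∀ x → 1# - (1# - x) ≈ x
  one-minus-one-minus x = begin
    1# - (1# - x)        ≈⟨ +-congˡ (sym (-‿+-comm 1# (- x))) ⟩
    1# + (- 1# + - - x)  ≈⟨ sym (+-assoc _ _ _) ⟩
    (1# - 1#) + - - x    ≈⟨ +-cong (-‿inverseʳ 1#) (-‿involutive x) ⟩
    0# + x               ≈⟨ +-identityˡ x ⟩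
    x                    ∎

  geometric-step : ∀ f p → (1# - p) + f * p ≈ 1# - (1# - f) * p
  geometric-step f p = begin
    (1# - p) + f * p         ≈⟨ +-assoc _ _ _ ⟩
    1# + (- p + f * p)       ≈⟨ +-congˡ (+-congˡ (sym (-‿involutive (f * p)))) ⟩
    1# + (- p + - - (f * p)) ≈⟨ +-congˡ (-‿+-comm p (- (f * p))) ⟩
    1# - (p + - (f * p))     ≈⟨ +-congˡ (-‿cong (+-cong (sym (*-identityˡ p)) (-‿distribˡ-* f p))) ⟩
    1# - (1# * p + - f * p)  ≈⟨ +-congˡ (-‿cong (sym (distribʳ p 1# (- f)))) ⟩
    1# - (1# - f) * p        ∎

  geometric-sum : ∀ f N → f * sumTo N (pow (1# - f)) ≈ 1# - pow (1# - f) (suc N)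
  geometric-sum f zero = begin
    f * (0# + 1#)          ≈⟨ trans (*-congˡ (+-identityˡ 1#)) (*-identityʳ f) ⟩
    f                      ≈⟨ sym (one-minus-one-minus f) ⟩
    1# - (1# - f)          ≈⟨ +-congˡ (-‿cong (sym (*-identityʳ _))) ⟩
    1# - (1# - f) * 1#     ∎
  geometric-sum f (suc N) = begin
    f * (sumTo N d^ + d^ (suc N))           ≈⟨ distribˡ f _ _ ⟩
    f * sumTo N d^ + f * d^ (suc N)         ≈⟨ +-congʳ (geometric-sum f N) ⟩
    (1# - d^ (suc N)) + f * d^ (suc N)      ≈⟨ geometric-step f (d^ (suc N)) ⟩
    1# - (1# - f) * d^ (suc N)              ∎
    where
    d^ = pow (1# - f)

-- Bivariate power series: Defs.Ser (coefficient of x^m y^k at m k) is the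
-- carrier of the ring of series in x over the series in y.
module Bivariate {c ℓ : Level} (R : CommutativeRing c ℓ) where
  open CommutativeRing R
  open Series R
  open FiniteSums R
  open RingProperties ring using (-0#≈0#)
  open SetoidReasoning setoid

  R1 R2 : CommutativeRing c ℓ
  R1 = PowerSeries.PSRing R
  R2 = PowerSeries.PSRing R1

  open CommutativeRing R2 public using ()
    renaming (_≈_ to _≈₂_; _+_ to _+₂_; _*_ to _*₂_; -_ to -₂_; _-_ to _-₂_; 1# to 1₂;
              refl to ≈₂-refl; sym to ≈₂-sym; trans to ≈₂-trans;
              *-cong to *₂-cong; *-comm to *₂-comm; *-assoc to *₂-assoc; *-identityʳ to *₂-identityʳ)
  module Σ₂ = Series R2
  module FiniteSums₂ = FiniteSums R2

  pw : Ser → ℕ → Ser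
  pw = Σ₂.pow

  Σ₂-eval : ∀ n (Φ : ℕ → Ser) m k → Σ₂.sumBelow n Φ m k ≡ sumBelow n (λ i → Φ i m k)
  Σ₂-eval zero    Φ m k = ≡.refl
  Σ₂-eval (suc n) Φ m k = ≡.cong (_+ Φ n m k) (Σ₂-eval n Φ m k)

  mul-eval : ∀ F G m k → (F *₂ G) m k ≈ sumTo m (λ i → sumTo k (λ j → F i j * G (m ∸ i) (k ∸ j)))
  mul-eval F G m k = ≡⇒≈ (eval (suc m) k)
    where
    eval : ∀ n k → Series.sumBelow R1 n (λ i → CommutativeRing._*_ R1 (F i) (G (m ∸ i))) k
                 ≡ sumBelow n (λ i → sumTo k (λ j → F i j * G (m ∸ i) (k ∸ j)))
    eval zero    k = ≡.refl
    eval (suc n) k = ≡.cong (_+ sumTo k (λ j → F n j * G (m ∸ n) (k ∸ j))) (eval n k)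

  mulS≈ : ∀ F G → (F *S G) ≈₂ (F *₂ G)
  mulS≈ F G m k = sym (mul-eval F G m k)

  oneS≈ : oneS ≈₂ 1₂
  oneS≈ zero    zero    = refl
  oneS≈ zero    (suc k) = refl
  oneS≈ (suc m) k       = refl

  pw-cong : ∀ {F G} n → F ≈₂ G → pw F n ≈₂ pw G n
  pw-cong zero    F≈G = ≈₂-refl
  pw-cong (suc n) F≈G = *₂-cong F≈G (pw-cong n F≈G)

  powS≈ : ∀ F n → (F ^S n) ≈₂ pw F n
  powS≈ F zero    = oneS≈
  powS≈ F (suc n) = ≈₂-trans (mulS≈ F (F ^S n)) (*₂-cong ≈₂-refl (powS≈ F n))

  agree : ∀ F X Y m k → (∀ i j → i ≤ m → j ≤ k → X i j ≈ Y i j) → (F *₂ X) m k ≈ (F *₂ Y) m k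
  agree F X Y m k X≈Y = trans (mul-eval F X m k) (trans
    (sum-cong-< (suc m) (λ i _ → sum-cong-< (suc k) (λ j _ → *-congˡ (X≈Y (m ∸ i) (k ∸ j) (m∸n≤m m i) (m∸n≤m k j)))))
    (sym (mul-eval F Y m k)))

  mul00 : ∀ F G → (F *₂ G) 0 0 ≈ F 0 0 * G 0 0
  mul00 F G = trans (mul-eval F G 0 0) (trans (+-identityˡ _) (+-identityˡ _))

  degree-drop : ∀ m k i j j′ → i ≤ m → j ≤ k → m +ℕ k < suc j′ → (i ≡ 0 → j ≡ 0 → ⊥) →
    (m ∸ i) +ℕ (k ∸ j) < j′
  degree-drop m       k       zero    zero    j′ _       _       _  nonzero = ⊥-elim (nonzero ≡.refl ≡.refl)
  degree-drop (suc m) k       (suc i) j       j′ (s≤s p) q       lt _ =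
    ≤-trans (s≤s (ℕₚ.+-mono-≤ (m∸n≤m m i) (m∸n≤m k j))) (≤-pred lt)
  degree-drop m       (suc k) zero    (suc j) j′ p       (s≤s q) lt _ =
    ≤-trans (s≤s (ℕₚ.+-monoʳ-≤ m (m∸n≤m k j))) (≤-trans (ℕₚ.≤-reflexive (≡.sym (+-suc m k))) (≤-pred lt))

  pw-order : ∀ F → F 0 0 ≈ 0# → ∀ j m k → m +ℕ k < j → pw F j m k ≈ 0#
  pw-order F F₀₀≈0 (suc j) m k lt = trans (mul-eval F (pw F j) m k)
    (sum-zero (suc m) (λ i ip → sum-zero (suc k) (λ l lp → term i l (≤-pred ip) (≤-pred lp))))
    where
    term : ∀ i l → i ≤ m → l ≤ k → F i l * pw F j (m ∸ i) (k ∸ l) ≈ 0#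
    term zero    zero    _  _  = trans (*-congʳ F₀₀≈0) (zeroˡ _)
    term zero    (suc l) ip lp =
      trans (*-congˡ (pw-order F F₀₀≈0 j m (k ∸ suc l) (degree-drop m k 0 (suc l) j ip lp lt (λ _ ())))) (zeroʳ _)
    term (suc i) l       ip lp =
      trans (*-congˡ (pw-order F F₀₀≈0 j (m ∸ suc i) (k ∸ l) (degree-drop m k (suc i) l j ip lp lt (λ ())))) (zeroʳ _)

  invS-eval : ∀ F i l → invS F i l ≈ sumTo (i +ℕ l) (λ j → pw (1₂ -₂ F) j i l)
  invS-eval F i l = sum-cong (suc (i +ℕ l)) (λ j → trans (powS≈ (oneS -S F) j i l)
     (pw-cong j (λ a b → +-congʳ (oneS≈ a b)) i l))

  unit-constant : ∀ F → F 0 0 ≈ 1# → (1₂ -₂ F) 0 0 ≈ 0#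
  unit-constant F F₀₀≈1 = trans (+-congˡ (-‿cong F₀₀≈1)) (-‿inverseʳ 1#)

  invS-truncate : ∀ F → F 0 0 ≈ 1# → ∀ N i l → i +ℕ l ≤ N →
    invS F i l ≈ Σ₂.sumTo N (pw (1₂ -₂ F)) i l
  invS-truncate F F₀₀≈1 N i l i+l≤N = begin
    invS F i l                                     ≈⟨ invS-eval F i l ⟩
    sumTo (i +ℕ l) (λ j → pw (1₂ -₂ F) j i l)     ≈⟨ sym (sum-extend (suc (i +ℕ l)) (suc N) (s≤s i+l≤N)
                                                        (λ j q _ → pw-order _ (unit-constant F F₀₀≈1) j i l q)) ⟩
    sumTo N (λ j → pw (1₂ -₂ F) j i l)            ≈⟨ ≡⇒≈ (≡.sym (Σ₂-eval (suc N) (pw (1₂ -₂ F)) i l)) ⟩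
    Σ₂.sumTo N (pw (1₂ -₂ F)) i l                 ∎

  invS-inverse : ∀ F → F 0 0 ≈ 1# → (F *₂ invS F) ≈₂ 1₂
  invS-inverse F F₀₀≈1 m k = begin
    (F *₂ invS F) m k                   ≈⟨ agree F (invS F) (Σ₂.sumTo N (pw d)) m k
                                             (λ i j ip jp → invS-truncate F F₀₀≈1 N i j (ℕₚ.+-mono-≤ ip jp)) ⟩
    (F *₂ Σ₂.sumTo N (pw d)) m k        ≈⟨ Geometric.geometric-sum R2 F N m k ⟩
    1₂ m k + - pw d (suc N) m k         ≈⟨ +-congˡ (-‿cong (pw-order d (unit-constant F F₀₀≈1) (suc N) m k ≤-refl)) ⟩
    1₂ m k + - 0#                       ≈⟨ +-congˡ -0#≈0# ⟩
    1₂ m k + 0#                         ≈⟨ +-identityʳ _ ⟩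
    1₂ m k                              ∎
    where
    N = m +ℕ k
    d = 1₂ -₂ F

  invS-cong : ∀ {F G} → F ≈₂ G → invS F ≈₂ invS G
  invS-cong {F} {G} F≈G i l = trans (invS-eval F i l) (trans
    (sum-cong (suc (i +ℕ l)) (λ j → pw-cong j (λ a b → +-congˡ (-‿cong (F≈G a b))) i l)) (sym (invS-eval G i l)))

-- Multiplication of a bivariate series by x^j, used to handle z = x M:
-- (x M)^j X = x^j (M^j X), whose coefficient at x^m y^k is that of M^j X
-- at x^{m-j} y^k (and 0 if m < j).
module TimesX {c ℓ : Level} (R : CommutativeRing c ℓ) where
  open CommutativeRing R
  open Series R
  open FiniteSums R
  open Bivariate R
  open SetoidReasoning setoid

  timesX : Ser → Ser
  timesX F zero    k = 0#
  timesX F (suc m) k = F m k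

  timesX-cong : ∀ {F G} → F ≈₂ G → timesX F ≈₂ timesX G
  timesX-cong F≈G zero    k = refl
  timesX-cong F≈G (suc m) k = F≈G m k

  timesX-*₂ : ∀ F G → (F *₂ timesX G) ≈₂ timesX (F *₂ G)
  timesX-*₂ F G zero k =
    trans (mul-eval F (timesX G) 0 k) (trans (+-identityˡ _) (sum-zero (suc k) (λ j _ → zeroʳ _)))
  timesX-*₂ F G (suc m) k = begin
    (F *₂ timesX G) (suc m) k
      ≈⟨ mul-eval F (timesX G) (suc m) k ⟩
    sumTo m (λ i → sumTo k (λ j → F i j * timesX G (suc m ∸ i) (k ∸ j))) +
      sumTo k (λ j → F (suc m) j * timesX G (m ∸ m) (k ∸ j))
      ≈⟨ +-cong (sum-cong-< (suc m) (λ i i≤m → sum-cong (suc k) (λ j → *-congˡ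
                   (≡⇒≈ (≡.cong (λ z → timesX G z (k ∸ j)) (+-∸-assoc 1 (≤-pred i≤m)))))))
                (sum-zero (suc k) (λ j _ → trans (*-congˡ (≡⇒≈ (≡.cong (λ z → timesX G z (k ∸ j)) (n∸n≡0 m))))
                                                  (zeroʳ _))) ⟩
    sumTo m (λ i → sumTo k (λ j → F i j * G (m ∸ i) (k ∸ j))) + 0#
      ≈⟨ +-identityʳ _ ⟩
    sumTo m (λ i → sumTo k (λ j → F i j * G (m ∸ i) (k ∸ j)))
      ≈⟨ sym (mul-eval F G m k) ⟩
    (F *₂ G) m k ∎

  timesX^ : ℕ → Ser → Ser
  timesX^ zero    G = G
  timesX^ (suc j) G = timesX (timesX^ j G)

  timesX^-cong : ∀ j {F G} → F ≈₂ G → timesX^ j F ≈₂ timesX^ j G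
  timesX^-cong zero    F≈G = F≈G
  timesX^-cong (suc j) F≈G = timesX-cong (timesX^-cong j F≈G)

  timesX^-timesX : ∀ j G → timesX^ j (timesX G) ≈₂ timesX (timesX^ j G)
  timesX^-timesX zero    G = ≈₂-refl
  timesX^-timesX (suc j) G = timesX-cong (timesX^-timesX j G)

  timesX^-*₂ : ∀ j F G → (F *₂ timesX^ j G) ≈₂ timesX^ j (F *₂ G)
  timesX^-*₂ zero    F G = ≈₂-refl
  timesX^-*₂ (suc j) F G = ≈₂-trans (timesX-*₂ F (timesX^ j G)) (timesX-cong (timesX^-*₂ j F G))

  timesX^-≤ : ∀ j G m k → j ≤ m → timesX^ j G m k ≈ G (m ∸ j) k
  timesX^-≤ zero    G m       k _       = refl
  timesX^-≤ (suc j) G (suc m) k (s≤s p) = timesX^-≤ j G m k p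

  timesX^-< : ∀ j G m k → m < j → timesX^ j G m k ≈ 0#
  timesX^-< (suc j) G zero    k _       = refl
  timesX^-< (suc j) G (suc m) k (s≤s p) = timesX^-< j G m k p

  pw-timesX : ∀ M j → pw (timesX M) j ≈₂ timesX^ j (pw M j)
  pw-timesX M zero    = ≈₂-refl
  pw-timesX M (suc j) =
    ≈₂-trans (*₂-cong ≈₂-refl (pw-timesX M j))
    (≈₂-trans (timesX^-*₂ j (timesX M) (pw M j))
    (≈₂-trans (timesX^-cong j (*₂-comm (timesX M) (pw M j)))
    (≈₂-trans (timesX^-cong j (timesX-*₂ (pw M j) M))
    (≈₂-trans (timesX^-cong j (timesX-cong (*₂-comm (pw M j) M)))
              (timesX^-timesX j (M *₂ pw M j))))))

  pw-timesX-*₂ : ∀ M j X → (pw (timesX M) j *₂ X) ≈₂ timesX^ j (pw M j *₂ X)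
  pw-timesX-*₂ M j X =
    ≈₂-trans (*₂-cong (pw-timesX M j) (≈₂-refl {X}))
    (≈₂-trans (*₂-comm (timesX^ j (pw M j)) X)
    (≈₂-trans (timesX^-*₂ j X (pw M j)) (timesX^-cong j (*₂-comm X (pw M j)))))

  scale : Carrier → Ser → Ser
  scale a F m k = a * F m k

  scale-*₂ : ∀ a F X m k → (scale a F *₂ X) m k ≈ a * (F *₂ X) m k
  scale-*₂ a F X m k = trans (mul-eval (scale a F) X m k) (trans
    (sum-cong (suc m) (λ i → trans (sum-cong (suc k) (λ j → *-assoc _ _ _)) (sym (sum-*ˡ (suc k) a _))))
    (trans (sym (sum-*ˡ (suc m) a _)) (*-congˡ (sym (mul-eval F X m k)))))

module WordSums {a b : Level} (A : CommutativeRing a b) where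
  open CommutativeRing A
  open Series A
  open FiniteSums A
  open SetoidReasoning setoid

  ΣL : List (List Step) → (List Step → Carrier) → Carrier
  ΣL L f = sumList (map f L)

  Σw : ℕ → (List Step → Carrier) → Carrier
  Σw n = ΣL (words n)

  ΣL-++ : ∀ xs ys f → ΣL (xs ++ ys) f ≈ ΣL xs f + ΣL ys f
  ΣL-++ []       ys f = sym (+-identityˡ _)
  ΣL-++ (x ∷ xs) ys f = trans (+-congˡ (ΣL-++ xs ys f)) (sym (+-assoc _ _ _))

  ΣL-concatMap : ∀ L g f → ΣL (concatMap g L) f ≈ ΣL L (λ x → ΣL (g x) f)
  ΣL-concatMap []      g f = refl
  ΣL-concatMap (x ∷ L) g f = trans (ΣL-++ (g x) (concatMap g L) f) (+-congˡ (ΣL-concatMap L g f))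

  ΣL-cong : ∀ L {f g} → (∀ w → f w ≈ g w) → ΣL L f ≈ ΣL L g
  ΣL-cong []      f≈g = refl
  ΣL-cong (x ∷ L) f≈g = +-cong (f≈g x) (ΣL-cong L f≈g)

  ΣL-+ : ∀ L f g → ΣL L (λ w → f w + g w) ≈ ΣL L f + ΣL L g
  ΣL-+ []      f g = sym (+-identityˡ _)
  ΣL-+ (x ∷ L) f g = trans (+-congˡ (ΣL-+ L f g)) (+-interchange _ _ _ _)

  ΣL-*ˡ : ∀ L c f → c * ΣL L f ≈ ΣL L (λ w → c * f w)
  ΣL-*ˡ []      c f = zeroʳ c
  ΣL-*ˡ (x ∷ L) c f = trans (distribˡ _ _ _) (+-congˡ (ΣL-*ˡ L c f))

  ΣL-*ʳ : ∀ L c f → ΣL L f * c ≈ ΣL L (λ w → f w * c)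
  ΣL-*ʳ []      c f = zeroˡ c
  ΣL-*ʳ (x ∷ L) c f = trans (distribʳ _ _ _) (+-congˡ (ΣL-*ʳ L c f))

  ΣL-0 : ∀ L {f} → (∀ w → f w ≈ 0#) → ΣL L f ≈ 0#
  ΣL-0 []      f≈0 = refl
  ΣL-0 (x ∷ L) f≈0 = trans (+-cong (f≈0 x) (ΣL-0 L f≈0)) (+-identityˡ _)

  ΣL-swap : ∀ L m (f : List Step → ℕ → Carrier) →
    ΣL L (λ w → sumBelow m (f w)) ≈ sumBelow m (λ j → ΣL L (λ w → f w j))
  ΣL-swap []      m f = sym (sum-zero m (λ _ _ → refl))
  ΣL-swap (x ∷ L) m f = trans (+-congˡ (ΣL-swap L m f)) (sym (sum-+ m (f x) (λ j → ΣL L (λ w → f w j))))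

  Σ3 : (Step → Carrier) → Carrier
  Σ3 φ = φ U + (φ H + (φ D + 0#))

  Σstep : (List Step → Carrier) → List Step → Carrier
  Σstep f w = Σ3 (λ x → f (x ∷ w))

  Σ3-+ : ∀ φ ψ → Σ3 (λ x → φ x + ψ x) ≈ Σ3 φ + Σ3 ψ
  Σ3-+ φ ψ = begin
    (φ U + ψ U) + ((φ H + ψ H) + ((φ D + ψ D) + 0#))
      ≈⟨ +-congˡ (+-congˡ (trans (+-congˡ (sym (+-identityʳ 0#))) (sym (+-interchange (φ D) 0# (ψ D) 0#)))) ⟩
    (φ U + ψ U) + ((φ H + ψ H) + ((φ D + 0#) + (ψ D + 0#)))
      ≈⟨ +-congˡ (+-interchange _ _ _ _) ⟩
    (φ U + ψ U) + ((φ H + (φ D + 0#)) + (ψ H + (ψ D + 0#)))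
      ≈⟨ +-interchange _ _ _ _ ⟩
    Σ3 φ + Σ3 ψ ∎

  ΣL-Σ3 : ∀ L (φ : List Step → Step → Carrier) → ΣL L (λ w → Σ3 (φ w)) ≈ Σ3 (λ x → ΣL L (λ w → φ w x))
  ΣL-Σ3 []      φ = sym (trans (+-congˡ (trans (+-congˡ (+-identityʳ 0#)) (+-identityʳ 0#))) (+-identityʳ 0#))
  ΣL-Σ3 (v ∷ L) φ = trans (+-congˡ (ΣL-Σ3 L φ)) (sym (Σ3-+ (φ v) (λ x → ΣL L (λ w → φ w x))))

  sum-Σ3 : ∀ n (φ : ℕ → Step → Carrier) → sumBelow n (λ i → Σ3 (φ i)) ≈ Σ3 (λ x → sumBelow n (λ i → φ i x))
  sum-Σ3 zero    φ = sym (trans (+-congˡ (trans (+-congˡ (+-identityʳ 0#)) (+-identityʳ 0#))) (+-identityʳ 0#))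
  sum-Σ3 (suc n) φ = trans (+-congʳ (sum-Σ3 n φ)) (sym (Σ3-+ (λ x → sumBelow n (λ i → φ i x)) (φ n)))

  Σw-suc : ∀ n f → Σw (suc n) f ≈ Σw n (Σstep f)
  Σw-suc n f = ΣL-concatMap (words n) _ f

  Σw-zero : ∀ f → Σw 0 f ≈ f []
  Σw-zero f = +-identityʳ _

  Σw-cong : ∀ n {f g} → (∀ w → f w ≈ g w) → Σw n f ≈ Σw n g
  Σw-cong n = ΣL-cong (words n)

  Σw-length : ∀ {n n′} f → n ≡ n′ → Σw n f ≈ Σw n′ f
  Σw-length f ≡.refl = refl

  Σw-cong-length : ∀ n {f g} → (∀ w → length w ≡ n → f w ≈ g w) → Σw n f ≈ Σw n g
  Σw-cong-length zero    f≈g = +-congʳ (f≈g [] ≡.refl)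
  Σw-cong-length (suc n) {f} {g} f≈g = begin
    Σw (suc n) f  ≈⟨ Σw-suc n f ⟩
    Σw n (Σstep f) ≈⟨ Σw-cong-length n (λ w len → +-cong (f≈g _ (≡.cong suc len))
                        (+-cong (f≈g _ (≡.cong suc len)) (+-congʳ (f≈g _ (≡.cong suc len))))) ⟩
    Σw n (Σstep g) ≈⟨ sym (Σw-suc n g) ⟩
    Σw (suc n) g  ∎

  Σw-+ : ∀ n f g → Σw n (λ w → f w + g w) ≈ Σw n f + Σw n g
  Σw-+ n = ΣL-+ (words n)

  Σw-*ˡ : ∀ n c f → c * Σw n f ≈ Σw n (λ w → c * f w)
  Σw-*ˡ n = ΣL-*ˡ (words n)

  Σw-*ʳ : ∀ n c f → Σw n f * c ≈ Σw n (λ w → f w * c)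
  Σw-*ʳ n = ΣL-*ʳ (words n)

  Σw-0 : ∀ n {f} → (∀ w → length w ≡ n → f w ≈ 0#) → Σw n f ≈ 0#
  Σw-0 n f≈0 = trans (Σw-cong-length n f≈0) (ΣL-0 (words n) (λ _ → refl))

  Σw-swap : ∀ n m (f : List Step → ℕ → Carrier) →
    Σw n (λ w → sumBelow m (f w)) ≈ sumBelow m (λ j → Σw n (λ w → f w j))
  Σw-swap n = ΣL-swap (words n)

  Σsplit : List Step → (List Step → List Step → Carrier) → Carrier
  Σsplit []      g = g [] []
  Σsplit (x ∷ w) g = g [] (x ∷ w) + Σsplit w (λ A C → g (x ∷ A) C)

  Σsplit-++ : ∀ w (F : List Step → List Step → List Step → Carrier) →
    Σsplit w (λ A C → F A C (A ++ C)) ≈ Σsplit w (λ A C → F A C w)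
  Σsplit-++ []      F = refl
  Σsplit-++ (x ∷ w) F = +-congˡ (Σsplit-++ w (λ A C X → F (x ∷ A) C (x ∷ X)))

  Σsplit-*ʳ : ∀ w g x → Σsplit w g * x ≈ Σsplit w (λ A C → g A C * x)
  Σsplit-*ʳ []      g x = refl
  Σsplit-*ʳ (y ∷ w) g x = trans (distribʳ _ _ _) (+-congˡ (Σsplit-*ʳ w _ x))

  Σsplit-0 : ∀ w {g} → (∀ A C → g A C ≈ 0#) → Σsplit w g ≈ 0#
  Σsplit-0 []      g≈0 = g≈0 [] []
  Σsplit-0 (x ∷ w) g≈0 = trans (+-cong (g≈0 [] _) (Σsplit-0 w (λ A C → g≈0 (x ∷ A) C))) (+-identityˡ _)

  Σw-Σsplit : ∀ n g → Σw n (λ w → Σsplit w g) ≈ sumTo n (λ i → Σw i (λ A → Σw (n ∸ i) (g A)))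
  Σw-Σsplit zero g = begin
    g [] [] + 0#                ≈⟨ sym (+-identityˡ _) ⟩
    0# + (g [] [] + 0#)         ≈⟨ +-congˡ (sym (+-identityʳ _)) ⟩
    0# + ((g [] [] + 0#) + 0#)  ∎
  Σw-Σsplit (suc n) g = begin
    Σw (suc n) (λ w → Σsplit w g)
      ≈⟨ Σw-suc n _ ⟩
    Σw n (Σstep (λ w → Σsplit w g))
      ≈⟨ Σw-cong n (λ w → Σ3-+ (λ x → g [] (x ∷ w)) (λ x → Σsplit w (g⁺ x))) ⟩
    Σw n (λ w → Σstep (g []) w + Σ3 (λ x → Σsplit w (g⁺ x)))
      ≈⟨ Σw-+ n _ _ ⟩
    Σw n (Σstep (g [])) + Σw n (λ w → Σ3 (λ x → Σsplit w (g⁺ x)))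
      ≈⟨ +-cong (sym (Σw-suc n (g []))) (ΣL-Σ3 (words n) (λ w x → Σsplit w (g⁺ x))) ⟩
    Σw (suc n) (g []) + Σ3 (λ x → Σw n (λ w → Σsplit w (g⁺ x)))
      ≈⟨ +-congˡ (Σ3-cong (λ x → Σw-Σsplit n (g⁺ x))) ⟩
    Σw (suc n) (g []) + Σ3 (λ x → sumTo n (λ i → Σw i (λ A → Σw (n ∸ i) (g⁺ x A))))
      ≈⟨ +-congˡ (sym (sum-Σ3 (suc n) (λ i x → Σw i (λ A → Σw (n ∸ i) (g⁺ x A))))) ⟩
    Σw (suc n) (g []) + sumTo n (λ i → Σ3 (λ x → Σw i (λ A → Σw (n ∸ i) (g⁺ x A))))
      ≈⟨ +-congˡ (sum-cong (suc n) (λ i → sym (ΣL-Σ3 (words i) (λ A x → Σw (n ∸ i) (g⁺ x A))))) ⟩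
    Σw (suc n) (g []) + sumTo n (λ i → Σw i (Σstep (λ A → Σw (n ∸ i) (g A))))
      ≈⟨ +-cong (sym (Σw-zero (λ A → Σw (suc n) (g A)))) (sum-cong (suc n) (λ i → sym (Σw-suc i _))) ⟩
    Σw 0 (λ A → Σw (suc n) (g A)) + sumTo n (λ i → Σw (suc i) (λ A → Σw (n ∸ i) (g A)))
      ≈⟨ sym (sum-front (suc n) _) ⟩
    sumTo (suc n) (λ i → Σw i (λ A → Σw (suc n ∸ i) (g A))) ∎
    where
    g⁺ : Step → List Step → List Step → Carrier
    g⁺ x A C = g (x ∷ A) C
    Σ3-cong : ∀ {φ ψ} → (∀ x → φ x ≈ ψ x) → Σ3 φ ≈ Σ3 ψ
    Σ3-cong φ≈ψ = +-cong (φ≈ψ U) (+-cong (φ≈ψ H) (+-congʳ (φ≈ψ D)))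

module WordFacts where

  startsWith : Step → List Step → Bool
  startsWith a []      = false
  startsWith a (c ∷ _) = ⌊ a ≟S c ⌋

  valid-length : ∀ h w → validFrom h w ≡ true → length w ≡ h +ℕ (2 *ℕ count U w +ℕ count H w)
  valid-length zero    []      _  = ≡.refl
  valid-length h       (U ∷ w) ok rewrite valid-length (suc h) w ok = up h (count U w) (count H w)
    where
    up : ∀ h x y → suc (suc h +ℕ (2 *ℕ x +ℕ y)) ≡ h +ℕ (2 *ℕ suc x +ℕ y)
    up = solve-∀
  valid-length h       (H ∷ w) ok rewrite valid-length h w ok = flat h (count U w) (count H w)
    where
    flat : ∀ h x y → suc (h +ℕ (2 *ℕ x +ℕ y)) ≡ h +ℕ (2 *ℕ x +ℕ suc y)
    flat = solve-∀
  valid-length (suc h) (D ∷ w) ok rewrite valid-length h w ok = ≡.refl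

  validFrom-Us : ∀ n h C → validFrom h (replicate n U ++ C) ≡ validFrom (n +ℕ h) C
  validFrom-Us zero    h C = ≡.refl
  validFrom-Us (suc n) h C rewrite validFrom-Us n (suc h) C | +-suc n h = ≡.refl

  validFrom-Hs : ∀ n h C → validFrom h (replicate n H ++ C) ≡ validFrom h C
  validFrom-Hs zero    h C = ≡.refl
  validFrom-Hs (suc n) h C = validFrom-Hs n h C

  count-++ : ∀ x A B → count x (A ++ B) ≡ count x A +ℕ count x B
  count-++ x []      B = ≡.refl
  count-++ x (y ∷ A) B with ⌊ x ≟S y ⌋
  ... | true  = ≡.cong suc (count-++ x A B)
  ... | false = count-++ x A B

  count-replicate : ∀ x n C → count x (replicate n x ++ C) ≡ n +ℕ count x C
  count-replicate x zero    C = ≡.refl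
  count-replicate x (suc n) C with x ≟S x
  ... | yes _   = ≡.cong suc (count-replicate x n C)
  ... | no  x≢x = ⊥-elim (x≢x ≡.refl)

  count-replicate-other : ∀ x y n C → x ≢ y → count x (replicate n y ++ C) ≡ count x C
  count-replicate-other x y zero    C _   = ≡.refl
  count-replicate-other x y (suc n) C x≢y with x ≟S y
  ... | yes x≡y = ⊥-elim (x≢y x≡y)
  ... | no  _   = count-replicate-other x y n C x≢y

  ≡ᵇ-refl : ∀ n → (n ≡ᵇ n) ≡ true
  ≡ᵇ-refl zero    = ≡.refl
  ≡ᵇ-refl (suc n) = ≡ᵇ-refl n

  ≡ᵇ-true : ∀ m n → (m ≡ᵇ n) ≡ true → m ≡ n
  ≡ᵇ-true zero    zero    _  = ≡.refl
  ≡ᵇ-true (suc m) (suc n) eq = ≡.cong suc (≡ᵇ-true m n eq)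

  ≡ᵇ-false : ∀ m n → m ≢ n → (m ≡ᵇ n) ≡ false
  ≡ᵇ-false m n m≢n with m ≡ᵇ n in eq
  ... | true  = ⊥-elim (m≢n (≡ᵇ-true m n eq))
  ... | false = ≡.refl

  ≡ᵇ-≟ : ∀ m n → ⌊ m ≟ℕ n ⌋ ≡ (m ≡ᵇ n)
  ≡ᵇ-≟ m n with m ≟ℕ n
  ... | yes ≡.refl = ≡.sym (≡ᵇ-refl m)
  ... | no  m≢n    = ≡.sym (≡ᵇ-false m n m≢n)

  ≡ᵇ-iff : ∀ a b c d → (a ≡ b → c ≡ d) → (c ≡ d → a ≡ b) → (a ≡ᵇ b) ≡ (c ≡ᵇ d)
  ≡ᵇ-iff a b c d to from with a ≡ᵇ b in e₁ | c ≡ᵇ d in e₂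
  ... | true  | true  = ≡.refl
  ... | false | false = ≡.refl
  ... | true  | false = ≡.trans (≡.sym (≡ᵇ-true′ (to (≡ᵇ-true a b e₁)))) e₂
    where
    ≡ᵇ-true′ : ∀ {x y} → x ≡ y → (x ≡ᵇ y) ≡ true
    ≡ᵇ-true′ {x} ≡.refl = ≡ᵇ-refl x
  ... | false | true  = ≡.trans (≡.sym e₁) (≡ᵇ-true′ (from (≡ᵇ-true c d e₂)))
    where
    ≡ᵇ-true′ : ∀ {x y} → x ≡ y → (x ≡ᵇ y) ≡ true
    ≡ᵇ-true′ {x} ≡.refl = ≡ᵇ-refl x

  ∧-true : ∀ {x y} → x ∧ y ≡ true → (x ≡ true) × (y ≡ true)
  ∧-true {true} {true} _ = ≡.refl , ≡.refl

  +-≡ᵇ-∸ : ∀ a y b → a ≤ b → (a +ℕ y ≡ᵇ b) ≡ (y ≡ᵇ b ∸ a)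
  +-≡ᵇ-∸ a y b a≤b = ≡ᵇ-iff (a +ℕ y) b y (b ∸ a)
    (λ { ≡.refl → ≡.sym (m+n∸m≡n a y) })
    (λ { ≡.refl → m+[n∸m]≡n a≤b })

  length-after-prefix : ∀ h {m₁ m k₁ k} → m₁ ≤ m → k₁ ≤ k →
    (h +ℕ (2 *ℕ m +ℕ k)) ∸ (2 *ℕ m₁ +ℕ k₁) ≡ h +ℕ (2 *ℕ (m ∸ m₁) +ℕ (k ∸ k₁))
  length-after-prefix h {m₁} {m} {k₁} {k} m₁≤m k₁≤k =
    ≡.subst₂ (λ M K → (h +ℕ (2 *ℕ M +ℕ K)) ∸ (2 *ℕ m₁ +ℕ k₁) ≡ h +ℕ (2 *ℕ (M ∸ m₁) +ℕ (K ∸ k₁)))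
      (m+[n∸m]≡n m₁≤m) (m+[n∸m]≡n k₁≤k) (split m₁ (m ∸ m₁) k₁ (k ∸ k₁))
    where
    regroup : ∀ h m₁ d₁ k₁ d₂ → h +ℕ (2 *ℕ (m₁ +ℕ d₁) +ℕ (k₁ +ℕ d₂)) ≡ (2 *ℕ m₁ +ℕ k₁) +ℕ (h +ℕ (2 *ℕ d₁ +ℕ d₂))
    regroup = solve-∀
    split : ∀ m₁ d₁ k₁ d₂ → (h +ℕ (2 *ℕ (m₁ +ℕ d₁) +ℕ (k₁ +ℕ d₂))) ∸ (2 *ℕ m₁ +ℕ k₁) ≡
            h +ℕ (2 *ℕ ((m₁ +ℕ d₁) ∸ m₁) +ℕ ((k₁ +ℕ d₂) ∸ k₁))
    split m₁ d₁ k₁ d₂ rewrite m+n∸m≡n m₁ d₁ | m+n∸m≡n k₁ d₂ | regroup h m₁ d₁ k₁ d₂ = m+n∸m≡n (2 *ℕ m₁ +ℕ k₁) _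

  prefix-length-bound : ∀ h {m₁ m k₁ k} → m₁ ≤ m → k₁ ≤ k → 2 *ℕ m₁ +ℕ k₁ < suc (h +ℕ (2 *ℕ m +ℕ k))
  prefix-length-bound h m₁≤m k₁≤k = s≤s (≤-trans (ℕₚ.+-mono-≤ (ℕₚ.*-monoʳ-≤ 2 m₁≤m) k₁≤k) (m≤n+m _ h))

  length-after-Hs : ∀ m k l → suc l ≤ k → (2 *ℕ m +ℕ k) ∸ suc l ≡ 2 *ℕ m +ℕ (k ∸ suc l)
  length-after-Hs m k l l<k = +-∸-assoc (2 *ℕ m) l<k

  length-after-Us : ∀ m k l → suc l ≤ m → (2 *ℕ m +ℕ k) ∸ suc l ≡ suc l +ℕ (2 *ℕ (m ∸ suc l) +ℕ k)
  length-after-Us m k l l<m =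
    ≡.subst (λ M → (2 *ℕ M +ℕ k) ∸ suc l ≡ suc l +ℕ (2 *ℕ (M ∸ suc l) +ℕ k)) (m+[n∸m]≡n l<m) (split (m ∸ suc l))
    where
    regroup : ∀ l d k → 2 *ℕ (suc l +ℕ d) +ℕ k ≡ suc l +ℕ (suc l +ℕ (2 *ℕ d +ℕ k))
    regroup = solve-∀
    split : ∀ d → (2 *ℕ (suc l +ℕ d) +ℕ k) ∸ suc l ≡ suc l +ℕ (2 *ℕ ((suc l +ℕ d) ∸ suc l) +ℕ k)
    split d = ≡.trans (≡.cong (_∸ suc l) (regroup l d k)) (≡.trans (m+n∸m≡n (suc l) _)
      (≡.cong (λ z → suc l +ℕ (2 *ℕ z +ℕ k)) (≡.sym (m+n∸m≡n (suc l) d))))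

module PathSums {a b : Level} (A : CommutativeRing a b) (t s : ℕ → CommutativeRing.Carrier A) where
  open CommutativeRing A
  open Series A
  open FiniteSums A
  open WordSums A
  open WordFacts
  open SetoidReasoning setoid

  ind : Bool → Carrier
  ind b = if b then 1# else 0#

  guard : Bool → Carrier → Carrier
  guard b x = if b then x else 0#

  guard-ind : ∀ b x → guard b x ≈ ind b * x
  guard-ind true  x = sym (*-identityˡ x)
  guard-ind false x = sym (zeroˡ x)

  guard-∧ : ∀ b₁ b₂ x → guard (b₁ ∧ b₂) x ≈ ind b₁ * guard b₂ x
  guard-∧ true  b₂ x = sym (*-identityˡ _)
  guard-∧ false b₂ x = sym (zeroˡ _)

  guard-cong : ∀ b {x y} → x ≈ y → guard b x ≈ guard b y
  guard-cong true  x≈y = x≈y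
  guard-cong false x≈y = refl

  guard-≡ : ∀ {b₁ b₂} x → b₁ ≡ b₂ → guard b₁ x ≈ guard b₂ x
  guard-≡ x ≡.refl = refl

  guard-false : ∀ b x → (b ≡ true → ⊥) → guard b x ≈ 0#
  guard-false true  x b≢true = ⊥-elim (b≢true ≡.refl)
  guard-false false x _      = refl

  guard-*ˡ : ∀ b c x → guard b (c * x) ≈ c * guard b x
  guard-*ˡ true  c x = refl
  guard-*ˡ false c x = sym (zeroʳ c)

  guard-split : ∀ b x → x ≈ guard (not b) x + guard b x
  guard-split true  x = sym (+-identityˡ x)
  guard-split false x = sym (+-identityʳ x)

  guard-swap : ∀ b₁ b₂ b₃ x → guard (b₁ ∧ (b₂ ∧ b₃)) x ≡ guard b₂ (guard (b₁ ∧ b₃) x)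
  guard-swap true  true  b₃ x = ≡.refl
  guard-swap true  false b₃ x = ≡.refl
  guard-swap false true  b₃ x = ≡.refl
  guard-swap false false b₃ x = ≡.refl

  descentThen : ℕ → List Step → Carrier
  descentThen h []      = 0#
  descentThen h (U ∷ _) = 0#
  descentThen h (H ∷ _) = 0#
  descentThen h (D ∷ B) = ind (validFrom h B)

  -- First-descent decomposition: a walk from height j + h + 1 to 0 splits
  -- uniquely as A D B, where A goes from height j to 0 (relative to h + 1)
  -- and B is a walk from height h to 0.
  valid-firstDescent : ∀ w j h →
    ind (validFrom (suc (j +ℕ h)) w) ≈ Σsplit w (λ A C → ind (validFrom j A) * descentThen h C)
  valid-firstDescent []      j       h = sym (zeroʳ _)
  valid-firstDescent (U ∷ w) j       h =
    trans (valid-firstDescent w (suc j) h) (sym (trans (+-congʳ (zeroʳ _)) (+-identityˡ _)))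
  valid-firstDescent (H ∷ w) j       h =
    trans (valid-firstDescent w j h) (sym (trans (+-congʳ (zeroʳ _)) (+-identityˡ _)))
  valid-firstDescent (D ∷ w) zero    h =
    sym (trans (+-cong (*-identityˡ _) (Σsplit-0 w (λ A C → zeroˡ _))) (+-identityʳ _))
  valid-firstDescent (D ∷ w) (suc j) h =
    trans (valid-firstDescent w j h) (sym (trans (+-congʳ (zeroˡ _)) (+-identityˡ _)))

  Σstep-startsWith : ∀ x (F : List Step → Carrier) w → Σstep (λ v → guard (startsWith x v) (F v)) w ≈ F (x ∷ w)
  Σstep-startsWith U F w = trans (+-congˡ (trans (+-identityˡ _) (+-identityˡ _))) (+-identityʳ _)
  Σstep-startsWith H F w = trans (+-identityˡ _) (trans (+-congˡ (+-identityˡ _)) (+-identityʳ _))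
  Σstep-startsWith D F w = trans (+-identityˡ _) (trans (+-identityˡ _) (+-identityʳ _))

  -- Words of length n starting with x, sorted by the length l + 1 of their leading x-run.
  Σw-leadingRun : ∀ x n (F : List Step → Carrier) →
    Σw n (λ w → guard (startsWith x w) (F w)) ≈
    sumBelow n (λ l → Σw (n ∸ suc l) (λ C → guard (not (startsWith x C)) (F (x ∷ (replicate l x ++ C)))))
  Σw-leadingRun x zero    F = +-identityʳ _
  Σw-leadingRun x (suc n) F = begin
    Σw (suc n) (λ w → guard (startsWith x w) (F w))
      ≈⟨ Σw-suc n _ ⟩
    Σw n (Σstep (λ w → guard (startsWith x w) (F w)))
      ≈⟨ Σw-cong n (λ w → trans (Σstep-startsWith x F w) (guard-split (startsWith x w) _)) ⟩
    Σw n (λ w → guard (not (startsWith x w)) (F (x ∷ w)) + guard (startsWith x w) (F (x ∷ w)))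
      ≈⟨ Σw-+ n _ _ ⟩
    Σw n (λ w → guard (not (startsWith x w)) (F (x ∷ w))) + Σw n (λ w → guard (startsWith x w) (F (x ∷ w)))
      ≈⟨ +-congˡ (Σw-leadingRun x n (λ w → F (x ∷ w))) ⟩
    Σw n (λ w → guard (not (startsWith x w)) (F (x ∷ w))) +
      sumBelow n (λ l → Σw (n ∸ suc l) (λ C → guard (not (startsWith x C)) (F (x ∷ x ∷ (replicate l x ++ C)))))
      ≈⟨ sym (sum-front n _) ⟩
    sumBelow (suc n) (λ l → Σw (suc n ∸ suc l) (λ C → guard (not (startsWith x C)) (F (x ∷ (replicate l x ++ C))))) ∎

  segWeight : Step → ℕ → Carrier
  segWeight U l = t l
  segWeight H l = s l
  segWeight D l = 1#

  -- Product of the weights of the maximal runs, scanning from the left;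
  -- runWeightFrom x l w is the weight of x^l w.
  runWeightFrom : Step → ℕ → List Step → Carrier
  runWeightFrom x l []      = segWeight x l
  runWeightFrom x l (y ∷ w) = if ⌊ x ≟S y ⌋ then runWeightFrom x (suc l) w else segWeight x l * runWeightFrom y 1 w

  runWeight : List Step → Carrier
  runWeight []      = 1#
  runWeight (x ∷ w) = runWeightFrom x 1 w

  runWeightFrom-run : ∀ x n l C → startsWith x C ≡ false →
    runWeightFrom x l (replicate n x ++ C) ≈ segWeight x (l +ℕ n) * runWeight C
  runWeightFrom-run x zero    l []      _ rewrite ℕₚ.+-identityʳ l = sym (*-identityʳ _)
  runWeightFrom-run x zero    l (y ∷ C) p rewrite ℕₚ.+-identityʳ l | p = refl
  runWeightFrom-run U (suc n) l C p rewrite +-suc l n = runWeightFrom-run U n (suc l) C p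
  runWeightFrom-run H (suc n) l C p rewrite +-suc l n = runWeightFrom-run H n (suc l) C p
  runWeightFrom-run D (suc n) l C p = runWeightFrom-run D n (suc l) C p

  runWeight-run : ∀ x l C → startsWith x C ≡ false → runWeight (x ∷ (replicate l x ++ C)) ≈ segWeight x (suc l) * runWeight C
  runWeight-run x l C p = runWeightFrom-run x l 1 C p

  runWeightFrom-D : ∀ l B → runWeightFrom D l B ≈ runWeight B
  runWeightFrom-D l []      = refl
  runWeightFrom-D l (U ∷ B) = *-identityˡ _
  runWeightFrom-D l (H ∷ B) = *-identityˡ _
  runWeightFrom-D l (D ∷ B) = trans (runWeightFrom-D (suc l) B) (sym (runWeightFrom-D 1 B))

  runWeightFrom-++D : ∀ x l A B → runWeightFrom x l (A ++ D ∷ B) ≈ runWeightFrom x l A * runWeight B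
  runWeightFrom-++D U l []      B = *-congˡ (runWeightFrom-D 1 B)
  runWeightFrom-++D H l []      B = *-congˡ (runWeightFrom-D 1 B)
  runWeightFrom-++D D l []      B = trans (runWeightFrom-D (suc l) B) (sym (*-identityˡ _))
  runWeightFrom-++D x l (y ∷ A) B with ⌊ x ≟S y ⌋
  ... | true  = runWeightFrom-++D x (suc l) A B
  ... | false = trans (*-congˡ (runWeightFrom-++D y 1 A B)) (sym (*-assoc _ _ _))

  -- The run weight is multiplicative across a down-step (down-runs weigh 1).
  runWeight-++D : ∀ A B → runWeight (A ++ D ∷ B) ≈ runWeight A * runWeight B
  runWeight-++D []      B = trans (runWeightFrom-D 1 B) (sym (*-identityˡ _))
  runWeight-++D (x ∷ A) B = runWeightFrom-++D x 1 A B

module Families {a b : Level} (A : CommutativeRing a b) (t s : ℕ → CommutativeRing.Carrier A) where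
  open CommutativeRing A
  open Series A
  open FiniteSums A
  open WordSums A
  open WordFacts
  open PathSums A t s
  open SetoidReasoning setoid

  pathTerm : ℕ → (List Step → Bool) → ℕ → ℕ → List Step → Carrier
  pathTerm h q m k w = guard (validFrom h w ∧ (q w ∧ ((count U w ≡ᵇ m) ∧ (count H w ≡ᵇ k)))) (runWeight w)

  paths : ℕ → (List Step → Bool) → ℕ → ℕ → Carrier
  paths h q m k = Σw (h +ℕ (2 *ℕ m +ℕ k)) (pathTerm h q m k)

  anyPath : List Step → Bool
  anyPath _ = true

  ind-convolution : ∀ x y m → ind (x +ℕ y ≡ᵇ m) ≈ sumTo m (λ i → ind (x ≡ᵇ i) * ind (y ≡ᵇ m ∸ i))
  ind-convolution x y m with x ℕₚ.≤? m
  ... | yes x≤m = sym (begin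
    sumTo m (λ i → ind (x ≡ᵇ i) * ind (y ≡ᵇ m ∸ i))
      ≈⟨ sum-single (suc m) x (s≤s x≤m) (λ i _ i≢x → trans (*-congʳ (ind-false (≡ᵇ-false x i (λ e → i≢x (≡.sym e))))) (zeroˡ _)) ⟩
    ind (x ≡ᵇ x) * ind (y ≡ᵇ m ∸ x)
      ≈⟨ *-congʳ (≡⇒≈ (≡.cong ind (≡ᵇ-refl x))) ⟩
    1# * ind (y ≡ᵇ m ∸ x)
      ≈⟨ *-identityˡ _ ⟩
    ind (y ≡ᵇ m ∸ x)
      ≈⟨ ≡⇒≈ (≡.cong ind (≡.sym (+-≡ᵇ-∸ x y m x≤m))) ⟩
    ind (x +ℕ y ≡ᵇ m) ∎)
    where
    ind-false : ∀ {b} → b ≡ false → ind b ≈ 0#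
    ind-false ≡.refl = refl
  ... | no x≰m = trans (ind-false (≡ᵇ-false (x +ℕ y) m (λ e → x≰m (≡.subst (x ≤_) e (m≤m+n x y)))))
                 (sym (sum-zero (suc m) (λ i i≤m → trans (*-congʳ (ind-false (≡ᵇ-false x i
                   (λ e → x≰m (≡.subst (_≤ m) (≡.sym e) (≤-pred i≤m)))))) (zeroˡ _))))
    where
    ind-false : ∀ {b} → b ≡ false → ind b ≈ 0#
    ind-false ≡.refl = refl

  restTerm : (List Step → Bool) → ℕ → ℕ → List Step → Carrier
  restTerm q m k X = guard (q X ∧ ((count U X ≡ᵇ m) ∧ (count H X ≡ᵇ k))) (runWeight X)

  splitTerm : (List Step → Bool) → ℕ → ℕ → ℕ → List Step → List Step → Carrier
  splitTerm q h m k A C = (ind (validFrom 0 A) * descentThen h C) * restTerm q m k (A ++ C)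

  pathTerm-firstDescent : ∀ q h m k w → pathTerm (suc h) q m k w ≈ Σsplit w (splitTerm q h m k)
  pathTerm-firstDescent q h m k w = begin
    pathTerm (suc h) q m k w
      ≈⟨ guard-∧ (validFrom (suc h) w) _ _ ⟩
    ind (validFrom (suc h) w) * restTerm q m k w
      ≈⟨ *-congʳ (valid-firstDescent w 0 h) ⟩
    Σsplit w (λ A C → ind (validFrom 0 A) * descentThen h C) * restTerm q m k w
      ≈⟨ Σsplit-*ʳ w _ _ ⟩
    Σsplit w (λ A C → (ind (validFrom 0 A) * descentThen h C) * restTerm q m k w)
      ≈⟨ sym (Σsplit-++ w (λ A C X → (ind (validFrom 0 A) * descentThen h C) * restTerm q m k X)) ⟩
    Σsplit w (splitTerm q h m k) ∎

  -- Only the continuations C = D ∷ B contribute.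
  Σw-descentThen : ∀ q h m k N i A → i ≤ N → Σw (suc N ∸ i) (splitTerm q h m k A) ≈
    Σw (N ∸ i) (λ B → (ind (validFrom 0 A) * ind (validFrom h B)) * restTerm q m k (A ++ D ∷ B))
  Σw-descentThen q h m k N i A i≤N = begin
    Σw (suc N ∸ i) (splitTerm q h m k A)     ≈⟨ Σw-length _ (+-∸-assoc 1 i≤N) ⟩
    Σw (suc (N ∸ i)) (splitTerm q h m k A)   ≈⟨ Σw-suc (N ∸ i) (splitTerm q h m k A) ⟩
    Σw (N ∸ i) (Σstep (splitTerm q h m k A)) ≈⟨ Σw-cong (N ∸ i) (λ B →
        trans (+-cong vanish (+-cong vanish (+-identityʳ _))) (trans (+-identityˡ _) (+-identityˡ _))) ⟩
    Σw (N ∸ i) (λ B → (ind (validFrom 0 A) * ind (validFrom h B)) * restTerm q m k (A ++ D ∷ B)) ∎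
    where
    vanish : ∀ {x} → (ind (validFrom 0 A) * 0#) * x ≈ 0#
    vanish = trans (*-congʳ (zeroʳ _)) (zeroˡ _)

  Σw-descentThen-empty : ∀ q h m k n A → Σw (n ∸ n) (splitTerm q h m k A) ≈ 0#
  Σw-descentThen-empty q h m k n A =
    trans (Σw-length _ (n∸n≡0 n)) (trans (Σw-zero (splitTerm q h m k A)) (trans (*-congʳ (zeroʳ _)) (zeroˡ _)))

  restTerm-++D : ∀ q → (∀ A B → q (A ++ D ∷ B) ≡ q A) → ∀ m k A B →
    restTerm q m k (A ++ D ∷ B) ≈
    guard (q A ∧ ((count U A +ℕ count U B ≡ᵇ m) ∧ (count H A +ℕ count H B ≡ᵇ k))) (runWeight A * runWeight B)
  restTerm-++D q q-prefix m k A B rewrite q-prefix A B | count-++ U A (D ∷ B) | count-++ H A (D ∷ B) =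
    guard-cong _ (runWeight-++D A B)

  guard-∧³ : ∀ b₁ b₂ b₃ x → guard (b₁ ∧ (b₂ ∧ b₃)) x ≈ ind b₁ * (ind b₂ * (ind b₃ * x))
  guard-∧³ b₁ b₂ b₃ x = trans (guard-∧ b₁ _ _) (*-congˡ (trans (guard-∧ b₂ _ _) (*-congˡ (guard-ind b₃ x))))

  guard-∧⁴ : ∀ b₁ b₂ b₃ b₄ x → guard (b₁ ∧ (b₂ ∧ (b₃ ∧ b₄))) x ≈ ind b₁ * (ind b₂ * (ind b₃ * (ind b₄ * x)))
  guard-∧⁴ b₁ b₂ b₃ b₄ x = trans (guard-∧ b₁ _ _) (*-congˡ (guard-∧³ b₂ b₃ b₄ x))

  *-sum-sum : ∀ c (F : ℕ → ℕ → Carrier) m k → c * sumTo m (λ i → sumTo k (F i)) ≈ sumTo m (λ i → sumTo k (λ j → c * F i j))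
  *-sum-sum c F m k = trans (sum-*ˡ (suc m) c _) (sum-cong (suc m) (λ i → sum-*ˡ (suc k) c _))

  distribute : ∀ v₀ vₕ q r₁ r₂ (a₁ b₁ a₂ b₂ : ℕ → Carrier) m k →
    (v₀ * vₕ) * (q * (sumTo m (λ i → a₁ i * b₁ i) * (sumTo k (λ j → a₂ j * b₂ j) * (r₁ * r₂)))) ≈
    sumTo m (λ i → sumTo k (λ j → (v₀ * (q * (a₁ i * (a₂ j * r₁)))) * (vₕ * (b₁ i * (b₂ j * r₂)))))
  distribute v₀ vₕ q r₁ r₂ a₁ b₁ a₂ b₂ m k = begin
    (v₀ * vₕ) * (q * (sumTo m (λ i → a₁ i * b₁ i) * (sumTo k (λ j → a₂ j * b₂ j) * (r₁ * r₂))))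
      ≈⟨ *-congˡ (*-congˡ (trans (*-congˡ (sum-*ʳ (suc k) _ _)) (sum-*ʳ (suc m) _ _))) ⟩
    (v₀ * vₕ) * (q * sumTo m (λ i → (a₁ i * b₁ i) * sumTo k (λ j → (a₂ j * b₂ j) * (r₁ * r₂))))
      ≈⟨ *-congˡ (*-congˡ (sum-cong (suc m) (λ i → sum-*ˡ (suc k) _ _))) ⟩
    (v₀ * vₕ) * (q * sumTo m (λ i → sumTo k (λ j → (a₁ i * b₁ i) * ((a₂ j * b₂ j) * (r₁ * r₂)))))
      ≈⟨ *-congˡ (*-sum-sum q _ m k) ⟩
    (v₀ * vₕ) * sumTo m (λ i → sumTo k (λ j → q * ((a₁ i * b₁ i) * ((a₂ j * b₂ j) * (r₁ * r₂)))))
      ≈⟨ *-sum-sum (v₀ * vₕ) _ m k ⟩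
    sumTo m (λ i → sumTo k (λ j → (v₀ * vₕ) * (q * ((a₁ i * b₁ i) * ((a₂ j * b₂ j) * (r₁ * r₂))))))
      ≈⟨ sum-cong (suc m) (λ i → sum-cong (suc k) (λ j → regroup v₀ vₕ q r₁ r₂ (a₁ i) (b₁ i) (a₂ j) (b₂ j))) ⟩
    sumTo m (λ i → sumTo k (λ j → (v₀ * (q * (a₁ i * (a₂ j * r₁)))) * (vₕ * (b₁ i * (b₂ j * r₂))))) ∎
    where
    open import Data.Vec using (_∷_; [])
    open import Data.Fin using (#_)
    open CMSolver *-commutativeMonoid using (prove; var; _⊕_)
    regroup : ∀ v₀ vₕ q r₁ r₂ a₁ b₁ a₂ b₂ → (v₀ * vₕ) * (q * ((a₁ * b₁) * ((a₂ * b₂) * (r₁ * r₂)))) ≈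
              (v₀ * (q * (a₁ * (a₂ * r₁)))) * (vₕ * (b₁ * (b₂ * r₂)))
    regroup v₀ vₕ q r₁ r₂ a₁ b₁ a₂ b₂ =
      prove 9 ((V₀ ⊕ Vₕ) ⊕ (Q ⊕ ((A₁ ⊕ B₁) ⊕ ((A₂ ⊕ B₂) ⊕ (R₁ ⊕ R₂)))))
              ((V₀ ⊕ (Q ⊕ (A₁ ⊕ (A₂ ⊕ R₁)))) ⊕ (Vₕ ⊕ (B₁ ⊕ (B₂ ⊕ R₂))))
              (v₀ ∷ vₕ ∷ q ∷ r₁ ∷ r₂ ∷ a₁ ∷ b₁ ∷ a₂ ∷ b₂ ∷ [])
      where
      V₀ = var (# 0); Vₕ = var (# 1); Q = var (# 2); R₁ = var (# 3); R₂ = var (# 4)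
      A₁ = var (# 5); B₁ = var (# 6); A₂ = var (# 7); B₂ = var (# 8)

  splitTerm-factor : ∀ q → (∀ A B → q (A ++ D ∷ B) ≡ q A) → ∀ h m k A B →
    (ind (validFrom 0 A) * ind (validFrom h B)) * restTerm q m k (A ++ D ∷ B) ≈
    sumTo m (λ m₁ → sumTo k (λ k₁ → pathTerm 0 q m₁ k₁ A * pathTerm h anyPath (m ∸ m₁) (k ∸ k₁) B))
  splitTerm-factor q q-prefix h m k A B = begin
    (ind (validFrom 0 A) * ind (validFrom h B)) * restTerm q m k (A ++ D ∷ B)
      ≈⟨ *-congˡ (trans (restTerm-++D q q-prefix m k A B) (guard-∧³ _ _ _ _)) ⟩
    (ind (validFrom 0 A) * ind (validFrom h B)) * (ind (q A) * (ind (count U A +ℕ count U B ≡ᵇ m) *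
        (ind (count H A +ℕ count H B ≡ᵇ k) * (runWeight A * runWeight B))))
      ≈⟨ *-congˡ (*-congˡ (*-cong (ind-convolution (count U A) (count U B) m)
                                   (*-congʳ (ind-convolution (count H A) (count H B) k)))) ⟩
    (ind (validFrom 0 A) * ind (validFrom h B)) * (ind (q A) *
       (sumTo m (λ i → ind (count U A ≡ᵇ i) * ind (count U B ≡ᵇ m ∸ i)) *
        (sumTo k (λ j → ind (count H A ≡ᵇ j) * ind (count H B ≡ᵇ k ∸ j)) * (runWeight A * runWeight B))))
      ≈⟨ distribute _ _ _ _ _ _ _ _ _ m k ⟩
    sumTo m (λ i → sumTo k (λ j →
      (ind (validFrom 0 A) * (ind (q A) * (ind (count U A ≡ᵇ i) * (ind (count H A ≡ᵇ j) * runWeight A)))) *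
      (ind (validFrom h B) * (ind (count U B ≡ᵇ m ∸ i) * (ind (count H B ≡ᵇ k ∸ j) * runWeight B)))))
      ≈⟨ sum-cong (suc m) (λ i → sum-cong (suc k) (λ j → sym (*-cong (guard-∧⁴ _ _ _ _ _) (guard-∧³ _ _ _ _)))) ⟩
    sumTo m (λ m₁ → sumTo k (λ k₁ → pathTerm 0 q m₁ k₁ A * pathTerm h anyPath (m ∸ m₁) (k ∸ k₁) B)) ∎

  Σw-Σw-convolution : ∀ i n (F G : List Step → ℕ → ℕ → Carrier) m k →
    Σw i (λ A → Σw n (λ B → sumTo m (λ m₁ → sumTo k (λ k₁ → F A m₁ k₁ * G B m₁ k₁)))) ≈
    sumTo m (λ m₁ → sumTo k (λ k₁ → Σw i (λ A → F A m₁ k₁) * Σw n (λ B → G B m₁ k₁)))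
  Σw-Σw-convolution i n F G m k = begin
    Σw i (λ A → Σw n (λ B → sumTo m (λ m₁ → sumTo k (λ k₁ → F A m₁ k₁ * G B m₁ k₁))))
      ≈⟨ Σw-cong i (λ A → trans (Σw-swap n (suc m) _) (sum-cong (suc m) (λ m₁ → trans (Σw-swap n (suc k) _)
            (sum-cong (suc k) (λ k₁ → sym (Σw-*ˡ n _ _)))))) ⟩
    Σw i (λ A → sumTo m (λ m₁ → sumTo k (λ k₁ → F A m₁ k₁ * Σw n (λ B → G B m₁ k₁))))
      ≈⟨ trans (Σw-swap i (suc m) _) (sum-cong (suc m) (λ m₁ → trans (Σw-swap i (suc k) _)
            (sum-cong (suc k) (λ k₁ → sym (Σw-*ʳ i _ _))))) ⟩
    sumTo m (λ m₁ → sumTo k (λ k₁ → Σw i (λ A → F A m₁ k₁) * Σw n (λ B → G B m₁ k₁))) ∎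

  -- Walks from height 0 with m₁ ups and k₁ flats have length 2 m₁ + k₁.
  pathTerm-wrongLength : ∀ q m₁ k₁ i A → length A ≡ i → i ≢ 2 *ℕ m₁ +ℕ k₁ → pathTerm 0 q m₁ k₁ A ≈ 0#
  pathTerm-wrongLength q m₁ k₁ i A len≡i i≢ = guard-false _ _ impossible
    where
    impossible : _ → ⊥
    impossible ok with ∧-true {validFrom 0 A} ok
    ... | valid , ok₂ with ∧-true {q A} ok₂
    ... | _ , ok₃ with ∧-true {count U A ≡ᵇ m₁} ok₃
    ... | ups , flats = i≢ (≡.trans (≡.sym len≡i) (≡.trans (valid-length 0 A valid)
          (≡.cong₂ (λ x y → 2 *ℕ x +ℕ y) (≡ᵇ-true (count U A) m₁ ups) (≡ᵇ-true (count H A) k₁ flats))))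

  paths-firstDescent : ∀ q → (∀ A B → q (A ++ D ∷ B) ≡ q A) → ∀ h m k →
    paths (suc h) q m k ≈ sumTo m (λ m₁ → sumTo k (λ k₁ → paths 0 q m₁ k₁ * paths h anyPath (m ∸ m₁) (k ∸ k₁)))
  paths-firstDescent q q-prefix h m k = begin
    paths (suc h) q m k
      ≈⟨ Σw-cong (suc N) (pathTerm-firstDescent q h m k) ⟩
    Σw (suc N) (λ w → Σsplit w (splitTerm q h m k))
      ≈⟨ Σw-Σsplit (suc N) _ ⟩
    sumBelow (suc N) pieces + pieces (suc N)
      ≈⟨ trans (+-congˡ (Σw-0 (suc N) (λ A _ → Σw-descentThen-empty q h m k (suc N) A))) (+-identityʳ _) ⟩
    sumBelow (suc N) pieces
      ≈⟨ sum-cong-< (suc N) (λ i i≤N → trans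
           (Σw-cong i (λ A → trans (Σw-descentThen q h m k N i A (≤-pred i≤N))
                               (Σw-cong (N ∸ i) (λ B → splitTerm-factor q q-prefix h m k A B))))
           (Σw-Σw-convolution i (N ∸ i) (λ A m₁ k₁ → pathTerm 0 q m₁ k₁ A)
                                        (λ B m₁ k₁ → pathTerm h anyPath (m ∸ m₁) (k ∸ k₁) B) m k)) ⟩
    sumBelow (suc N) (λ i → sumTo m (λ m₁ → sumTo k (λ k₁ → product i m₁ k₁)))
      ≈⟨ trans (sum-swap (suc N) (suc m) _) (sum-cong (suc m) (λ m₁ → sum-swap (suc N) (suc k) _)) ⟩
    sumTo m (λ m₁ → sumTo k (λ k₁ → sumBelow (suc N) (λ i → product i m₁ k₁)))
      ≈⟨ sum-cong-< (suc m) (λ m₁ p → sum-cong-< (suc k) (λ k₁ q → only-right-length m₁ k₁ (≤-pred p) (≤-pred q))) ⟩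
    sumTo m (λ m₁ → sumTo k (λ k₁ → paths 0 q m₁ k₁ * paths h anyPath (m ∸ m₁) (k ∸ k₁))) ∎
    where
    N = h +ℕ (2 *ℕ m +ℕ k)
    pieces : ℕ → Carrier
    pieces i = Σw i (λ A → Σw (suc N ∸ i) (splitTerm q h m k A))
    product : ℕ → ℕ → ℕ → Carrier
    product i m₁ k₁ = Σw i (pathTerm 0 q m₁ k₁) * Σw (N ∸ i) (pathTerm h anyPath (m ∸ m₁) (k ∸ k₁))
    -- Only the prefix length i = 2 m₁ + k₁ contributes.
    only-right-length : ∀ m₁ k₁ → m₁ ≤ m → k₁ ≤ k →
      sumBelow (suc N) (λ i → product i m₁ k₁) ≈ paths 0 q m₁ k₁ * paths h anyPath (m ∸ m₁) (k ∸ k₁)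
    only-right-length m₁ k₁ m₁≤m k₁≤k = trans
      (sum-single (suc N) (2 *ℕ m₁ +ℕ k₁) (prefix-length-bound h m₁≤m k₁≤k)
         (λ i _ i≢ → trans (*-congʳ (Σw-0 i (λ A len → pathTerm-wrongLength q m₁ k₁ i A len i≢))) (zeroˡ _)))
      (*-congˡ (Σw-length _ (length-after-prefix h m₁≤m k₁≤k)))

module FirstStep {a b : Level} (A : CommutativeRing a b) (t s : ℕ → CommutativeRing.Carrier A) where
  open CommutativeRing A
  open Series A
  open FiniteSums A
  open WordSums A
  open WordFacts
  open PathSums A t s
  open Families A t s
  open SetoidReasoning setoid

  noLeadingH noLeadingU : List Step → Bool
  noLeadingH w = not (startsWith H w)
  noLeadingU w = not (startsWith U w)

  paths-cong : ∀ h q q′ m k → (∀ w → q w ≡ q′ w) → paths h q m k ≈ paths h q′ m k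
  paths-cong h q q′ m k q≡q′ = Σw-cong (h +ℕ (2 *ℕ m +ℕ k)) (λ w → guard-≡ (runWeight w)
    (≡.cong (λ z → validFrom h w ∧ (z ∧ ((count U w ≡ᵇ m) ∧ (count H w ≡ᵇ k)))) (q≡q′ w)))

  leadingH-term : ∀ m k l C → l < k →
    guard (noLeadingH C) (pathTerm 0 anyPath m k (H ∷ (replicate l H ++ C))) ≈ s (suc l) * pathTerm 0 noLeadingH m (k ∸ suc l) C
  leadingH-term m k l C l<k
    rewrite guard-swap (validFrom 0 C) (noLeadingH C) ((count U C ≡ᵇ m) ∧ (count H C ≡ᵇ k ∸ suc l)) (runWeight C)
    with startsWith H C in eq
  ... | true = sym (zeroʳ _)
  ... | false rewrite validFrom-Hs (suc l) 0 C | count-replicate-other U H (suc l) C (λ ()) | count-replicate H (suc l) C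
    = trans (guard-≡ _ (≡.cong (λ z → validFrom 0 C ∧ ((count U C ≡ᵇ m) ∧ z)) (+-≡ᵇ-∸ (suc l) (count H C) k l<k)))
            (trans (guard-cong _ (runWeight-run H l C eq)) (guard-*ˡ _ _ _))

  leadingH-term-long : ∀ m k l C → k ≤ l →
    guard (noLeadingH C) (pathTerm 0 anyPath m k (H ∷ (replicate l H ++ C))) ≈ 0#
  leadingH-term-long m k l C k≤l with startsWith H C
  ... | true = refl
  ... | false rewrite validFrom-Hs (suc l) 0 C | count-replicate-other U H (suc l) C (λ ()) | count-replicate H (suc l) C
                    | ≡ᵇ-false (suc l +ℕ count H C) k (λ e → ℕₚ.<-irrefl (≡.sym e) (≤-trans (s≤s k≤l) (s≤s (m≤m+n l (count H C)))))
                    with validFrom 0 C | count U C ≡ᵇ m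
  ... | true  | true  = refl
  ... | true  | false = refl
  ... | false | _     = refl

  leadingH : ∀ m k → paths 0 (startsWith H) m k ≈ sumBelow k (λ l → s (suc l) * paths 0 noLeadingH m (k ∸ suc l))
  leadingH m k = begin
    paths 0 (startsWith H) m k
      ≈⟨ Σw-cong n (λ w → ≡⇒≈ (guard-swap (validFrom 0 w) (startsWith H w) _ (runWeight w))) ⟩
    Σw n (λ w → guard (startsWith H w) (pathTerm 0 anyPath m k w))
      ≈⟨ Σw-leadingRun H n (pathTerm 0 anyPath m k) ⟩
    sumBelow n (λ l → Σw (n ∸ suc l) (λ C → guard (noLeadingH C) (pathTerm 0 anyPath m k (H ∷ (replicate l H ++ C)))))
      ≈⟨ sum-extend k n (m≤n+m k _) (λ l k≤l _ → Σw-0 (n ∸ suc l) (λ C _ → leadingH-term-long m k l C k≤l)) ⟩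
    sumBelow k (λ l → Σw (n ∸ suc l) (λ C → guard (noLeadingH C) (pathTerm 0 anyPath m k (H ∷ (replicate l H ++ C)))))
      ≈⟨ sum-cong-< k (λ l l<k → trans (Σw-cong (n ∸ suc l) (λ C → leadingH-term m k l C l<k))
            (trans (sym (Σw-*ˡ (n ∸ suc l) (s (suc l)) (pathTerm 0 noLeadingH m (k ∸ suc l))))
                   (*-congˡ (Σw-length _ (length-after-Hs m k l l<k))))) ⟩
    sumBelow k (λ l → s (suc l) * paths 0 noLeadingH m (k ∸ suc l)) ∎
    where
    n = 2 *ℕ m +ℕ k

  leadingU-term : ∀ m k l C → l < m →
    guard (noLeadingU C) (pathTerm 0 anyPath m k (U ∷ (replicate l U ++ C))) ≈ t (suc l) * pathTerm (suc l) noLeadingU (m ∸ suc l) k C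
  leadingU-term m k l C l<m
    rewrite guard-swap (validFrom (suc l) C) (noLeadingU C) ((count U C ≡ᵇ m ∸ suc l) ∧ (count H C ≡ᵇ k)) (runWeight C)
    with startsWith U C in eq
  ... | true = sym (zeroʳ _)
  ... | false rewrite validFrom-Us (suc l) 0 C | ℕₚ.+-identityʳ l | count-replicate U (suc l) C | count-replicate-other H U (suc l) C (λ ())
    = trans (guard-≡ _ (≡.cong (λ z → validFrom (suc l) C ∧ (z ∧ (count H C ≡ᵇ k))) (+-≡ᵇ-∸ (suc l) (count U C) m l<m)))
            (trans (guard-cong _ (runWeight-run U l C eq)) (guard-*ˡ _ _ _))

  leadingU-term-long : ∀ m k l C → m ≤ l →
    guard (noLeadingU C) (pathTerm 0 anyPath m k (U ∷ (replicate l U ++ C))) ≈ 0#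
  leadingU-term-long m k l C m≤l with startsWith U C
  ... | true = refl
  ... | false rewrite count-replicate U (suc l) C
                    | ≡ᵇ-false (suc l +ℕ count U C) m (λ e → ℕₚ.<-irrefl (≡.sym e) (≤-trans (s≤s m≤l) (s≤s (m≤m+n l (count U C)))))
                    with validFrom 0 (U ∷ (replicate l U ++ C))
  ... | true  = refl
  ... | false = refl

  leadingU : ∀ m k → paths 0 (startsWith U) m k ≈ sumBelow m (λ l → t (suc l) * paths (suc l) noLeadingU (m ∸ suc l) k)
  leadingU m k = begin
    paths 0 (startsWith U) m k
      ≈⟨ Σw-cong n (λ w → ≡⇒≈ (guard-swap (validFrom 0 w) (startsWith U w) _ (runWeight w))) ⟩
    Σw n (λ w → guard (startsWith U w) (pathTerm 0 anyPath m k w))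
      ≈⟨ Σw-leadingRun U n (pathTerm 0 anyPath m k) ⟩
    sumBelow n (λ l → Σw (n ∸ suc l) (λ C → guard (noLeadingU C) (pathTerm 0 anyPath m k (U ∷ (replicate l U ++ C)))))
      ≈⟨ sum-extend m n (≤-trans (m≤m+n m _) (m≤m+n _ k)) (λ l m≤l _ → Σw-0 (n ∸ suc l) (λ C _ → leadingU-term-long m k l C m≤l)) ⟩
    sumBelow m (λ l → Σw (n ∸ suc l) (λ C → guard (noLeadingU C) (pathTerm 0 anyPath m k (U ∷ (replicate l U ++ C)))))
      ≈⟨ sum-cong-< m (λ l l<m → trans (Σw-cong (n ∸ suc l) (λ C → leadingU-term m k l C l<m))
            (trans (sym (Σw-*ˡ (n ∸ suc l) (t (suc l)) (pathTerm (suc l) noLeadingU (m ∸ suc l) k)))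
                   (*-congˡ (Σw-length _ (length-after-Us m k l l<m))))) ⟩
    sumBelow m (λ l → t (suc l) * paths (suc l) noLeadingU (m ∸ suc l) k) ∎
    where
    n = 2 *ℕ m +ℕ k

  isEmpty : List Step → Bool
  isEmpty []      = true
  isEmpty (_ ∷ _) = false

  pathTerm-firstLetter : ∀ q m k w → pathTerm 0 q m k w ≈
    guard (isEmpty w) (pathTerm 0 q m k w) + (pathTerm 0 (λ v → q v ∧ startsWith U v) m k w + pathTerm 0 (λ v → q v ∧ startsWith H v) m k w)
  pathTerm-firstLetter q m k [] rewrite Boolₚ.∧-zeroʳ (q []) =
    trans (sym (+-identityʳ _)) (+-congˡ (sym (+-identityʳ _)))
  pathTerm-firstLetter q m k (U ∷ w)
    rewrite Boolₚ.∧-zeroʳ (q (U ∷ w)) | Boolₚ.∧-identityʳ (q (U ∷ w)) | Boolₚ.∧-zeroʳ (validFrom 1 w) =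
    trans (sym (+-identityʳ _)) (sym (+-identityˡ _))
  pathTerm-firstLetter q m k (H ∷ w)
    rewrite Boolₚ.∧-zeroʳ (q (H ∷ w)) | Boolₚ.∧-identityʳ (q (H ∷ w)) | Boolₚ.∧-zeroʳ (validFrom 0 w) =
    trans (sym (+-identityˡ _)) (sym (+-identityˡ _))
  pathTerm-firstLetter q m k (D ∷ w) = sym (trans (+-identityˡ _) (+-identityˡ _))

  Σw-empty : ∀ q m k → q [] ≡ true → Σw (2 *ℕ m +ℕ k) (λ w → guard (isEmpty w) (pathTerm 0 q m k w)) ≈ oneS m k
  Σw-empty q zero    zero    q[] rewrite q[] = +-identityʳ _
  Σw-empty q zero    (suc k) _   = Σw-0 (suc k) (λ { [] () ; (_ ∷ _) _ → refl })
  Σw-empty q (suc m) k       _   = Σw-0 (2 *ℕ suc m +ℕ k) (λ { [] () ; (_ ∷ _) _ → refl })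

  paths-firstLetter : ∀ q m k → q [] ≡ true →
    paths 0 q m k ≈ oneS m k + (paths 0 (λ v → q v ∧ startsWith U v) m k + paths 0 (λ v → q v ∧ startsWith H v) m k)
  paths-firstLetter q m k q[] = trans (Σw-cong n (pathTerm-firstLetter q m k))
    (trans (Σw-+ n _ _) (+-cong (Σw-empty q m k q[]) (Σw-+ n _ _)))
    where
    n = 2 *ℕ m +ℕ k

  paths-none : ∀ h m k → paths h (λ _ → false) m k ≈ 0#
  paths-none h m k = Σw-0 (h +ℕ (2 *ℕ m +ℕ k))
    (λ w _ → ≡⇒≈ (≡.cong (λ z → guard z (runWeight w)) (Boolₚ.∧-zeroʳ (validFrom h w))))

  M-firstLetter : ∀ m k → paths 0 anyPath m k ≈ oneS m k + (paths 0 (startsWith U) m k + paths 0 (startsWith H) m k)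
  M-firstLetter m k = paths-firstLetter anyPath m k ≡.refl

  NU-firstLetter : ∀ m k → paths 0 noLeadingU m k ≈ oneS m k + paths 0 (startsWith H) m k
  NU-firstLetter m k = trans (paths-firstLetter noLeadingU m k ≡.refl) (+-congˡ (trans
    (+-cong (trans (paths-cong 0 _ (λ _ → false) m k none) (paths-none 0 m k)) (paths-cong 0 _ (startsWith H) m k same))
    (+-identityˡ _)))
    where
    none : ∀ w → (noLeadingU w ∧ startsWith U w) ≡ false
    none []      = ≡.refl
    none (U ∷ w) = ≡.refl
    none (H ∷ w) = ≡.refl
    none (D ∷ w) = ≡.refl
    same : ∀ w → (noLeadingU w ∧ startsWith H w) ≡ startsWith H w
    same []      = ≡.refl
    same (U ∷ w) = ≡.refl
    same (H ∷ w) = ≡.refl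
    same (D ∷ w) = ≡.refl

  NH-firstLetter : ∀ m k → paths 0 noLeadingH m k ≈ oneS m k + paths 0 (startsWith U) m k
  NH-firstLetter m k = trans (paths-firstLetter noLeadingH m k ≡.refl) (+-congˡ (trans
    (+-cong (paths-cong 0 _ (startsWith U) m k same) (trans (paths-cong 0 _ (λ _ → false) m k none) (paths-none 0 m k)))
    (+-identityʳ _)))
    where
    none : ∀ w → (noLeadingH w ∧ startsWith H w) ≡ false
    none []      = ≡.refl
    none (U ∷ w) = ≡.refl
    none (H ∷ w) = ≡.refl
    none (D ∷ w) = ≡.refl
    same : ∀ w → (noLeadingH w ∧ startsWith U w) ≡ startsWith U w
    same []      = ≡.refl
    same (U ∷ w) = ≡.refl
    same (H ∷ w) = ≡.refl
    same (D ∷ w) = ≡.refl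

-- The weight Π t_i^{u_i(P)} Π s_i^{h_i(P)} of Defs equals the run weight,
-- so M is the family of all walks from height 0.
module RunLists where

  runCount : Step → ℕ → List (Step × ℕ) → ℕ
  runCount x i []            = 0
  runCount x i ((y , n) ∷ r) = if ⌊ x ≟S y ⌋ ∧ ⌊ i ≟ℕ n ⌋ then suc (runCount x i r) else runCount x i r

  segCount≡runCount : ∀ x i P → segCount x i P ≡ runCount x i (runs P)
  segCount≡runCount x i []      = ≡.refl
  segCount≡runCount x i (y ∷ P) with runs P | segCount≡runCount x i P
  ... | []          | _  = ≡.refl
  ... | (z , n) ∷ r | ih with y ≟S z
  ...   | yes ≡.refl = bump (⌊ x ≟S y ⌋ ∧ ⌊ i ≟ℕ n ⌋) ih
    where
    bump : ∀ c {u v} → (if c then suc u else u) ≡ (if c then suc v else v) →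
           {d : Bool} → (if d then suc u else u) ≡ (if d then suc v else v)
    bump true  e {true}  = e
    bump true  e {false} = ℕₚ.suc-injective e
    bump false e {true}  = ≡.cong suc e
    bump false e {false} = e
  ...   | no _ = ≡.cong (λ z → if ⌊ x ≟S y ⌋ ∧ ⌊ i ≟ℕ 1 ⌋ then suc z else z) ih

  addRun : Step → ℕ → List (Step × ℕ) → List (Step × ℕ)
  addRun x l []            = (x , l) ∷ []
  addRun x l ((y , n) ∷ r) with x ≟S y
  ... | yes _ = (y , l +ℕ n) ∷ r
  ... | no  _ = (x , l) ∷ (y , n) ∷ r

  runs-∷ : ∀ x w → runs (x ∷ w) ≡ addRun x 1 (runs w)
  runs-∷ x w with runs w
  ... | []          = ≡.refl
  ... | (y , n) ∷ r with x ≟S y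
  ...   | yes _ = ≡.refl
  ...   | no  _ = ≡.refl

  ≟S-refl : ∀ x → (x ≟S x) ≡ yes ≡.refl
  ≟S-refl U = ≡.refl
  ≟S-refl H = ≡.refl
  ≟S-refl D = ≡.refl

  RunsBounded : ℕ → List (Step × ℕ) → Set
  RunsBounded L []            = ⊤
  RunsBounded L ((y , n) ∷ r) = (1 ≤ n) × (n ≤ L) × RunsBounded L r

  RunsBounded-suc : ∀ {L} r → RunsBounded L r → RunsBounded (suc L) r
  RunsBounded-suc []            _              = tt
  RunsBounded-suc ((y , n) ∷ r) (p , q , rest) = p , m≤n⇒m≤1+n q , RunsBounded-suc r rest

  RunsBounded-addRun : ∀ {L} x r → RunsBounded L r → RunsBounded (suc L) (addRun x 1 r)
  RunsBounded-addRun x []            _ = s≤s z≤n , s≤s z≤n , tt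
  RunsBounded-addRun x ((y , n) ∷ r) (p , q , rest) with x ≟S y
  ... | yes _ = s≤s z≤n , s≤s q , RunsBounded-suc r rest
  ... | no  _ = s≤s z≤n , s≤s z≤n , p , m≤n⇒m≤1+n q , RunsBounded-suc r rest

  runs-bounded : ∀ P → RunsBounded (length P) (runs P)
  runs-bounded []      = tt
  runs-bounded (x ∷ P) rewrite runs-∷ x P = RunsBounded-addRun x (runs P) (runs-bounded P)

module WeightIsRunWeight {a b : Level} (A : CommutativeRing a b) (t s : ℕ → CommutativeRing.Carrier A) where
  open CommutativeRing A
  open Series A
  open FiniteSums A using (≡⇒≈)
  open WordSums A
  open WordFacts
  open PathSums A t s
  open Families A t s
  open RunLists
  open SetoidReasoning setoid

  runListWeight : List (Step × ℕ) → Carrier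
  runListWeight []            = 1#
  runListWeight ((x , n) ∷ r) = segWeight x n * runListWeight r

  addRun-merge : ∀ x l r → runListWeight (addRun x l (addRun x 1 r)) ≈ runListWeight (addRun x (suc l) r)
  addRun-merge x l [] rewrite ≟S-refl x | ℕₚ.+-comm l 1 = refl
  addRun-merge x l ((y , n) ∷ r) with x ≟S y
  ... | yes ≡.refl rewrite ≟S-refl x | +-suc l n = refl
  ... | no  _      rewrite ≟S-refl x | ℕₚ.+-comm l 1 = refl

  addRun-other : ∀ x y l r → x ≢ y → runListWeight (addRun x l (addRun y 1 r)) ≈ segWeight x l * runListWeight (addRun y 1 r)
  addRun-other x y l [] x≢y with x ≟S y
  ... | yes e = ⊥-elim (x≢y e)
  ... | no  _ = refl
  addRun-other x y l ((z , n) ∷ r) x≢y with y ≟S z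
  addRun-other x y l ((z , n) ∷ r) x≢y | yes ≡.refl with x ≟S y
  ... | yes e = ⊥-elim (x≢y e)
  ... | no  _ = refl
  addRun-other x y l ((z , n) ∷ r) x≢y | no _ with x ≟S y
  ... | yes e = ⊥-elim (x≢y e)
  ... | no  _ = refl

  runWeightFrom≈runListWeight : ∀ x l w → runWeightFrom x l w ≈ runListWeight (addRun x l (runs w))
  runWeightFrom≈runListWeight x l []      = sym (*-identityʳ _)
  runWeightFrom≈runListWeight x l (y ∷ w) rewrite runs-∷ y w with x ≟S y
  ... | yes ≡.refl = trans (runWeightFrom≈runListWeight x (suc l) w) (sym (addRun-merge x l (runs w)))
  ... | no  x≢y    = trans (*-congˡ (runWeightFrom≈runListWeight y 1 w)) (sym (addRun-other x y l (runs w) x≢y))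

  runWeight≈runListWeight : ∀ P → runWeight P ≈ runListWeight (runs P)
  runWeight≈runListWeight []      = refl
  runWeight≈runListWeight (x ∷ w) rewrite runs-∷ x w = runWeightFrom≈runListWeight x 1 w

  prod-cong : ∀ L {φ ψ : ℕ → Carrier} → (∀ i → 1 ≤ i → i ≤ L → φ i ≈ ψ i) → prod1To L φ ≈ prod1To L ψ
  prod-cong zero    _   = refl
  prod-cong (suc L) φ≈ψ = *-cong (prod-cong L (λ i p q → φ≈ψ i p (m≤n⇒m≤1+n q))) (φ≈ψ (suc L) (s≤s z≤n) ≤-refl)

  prod-one : ∀ L → prod1To L (λ _ → 1#) ≈ 1#
  prod-one zero    = refl
  prod-one (suc L) = trans (*-identityʳ _) (prod-one L)

  prod-bump : ∀ L n (f : ℕ → Carrier) (g : ℕ → ℕ) → 1 ≤ n → n ≤ L →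
    prod1To L (λ i → pow (f i) (if ⌊ i ≟ℕ n ⌋ then suc (g i) else g i)) ≈ f n * prod1To L (λ i → pow (f i) (g i))
  prod-bump zero    zero f g () _
  prod-bump (suc L) n f g 1≤n n≤L with suc L ≟ℕ n
  ... | yes ≡.refl = begin
    prod1To L bumped * (f (suc L) * pow (f (suc L)) (g (suc L)))
      ≈⟨ *-congʳ (prod-cong L (λ i _ i≤L → ≡⇒≈ (≡.cong (λ z → pow (f i) (if z then suc (g i) else g i))
            (≡.trans (≡ᵇ-≟ i (suc L)) (≡ᵇ-false i (suc L) (λ e → ℕₚ.<-irrefl e (s≤s i≤L))))))) ⟩
    prod1To L (λ i → pow (f i) (g i)) * (f (suc L) * pow (f (suc L)) (g (suc L)))
      ≈⟨ trans (sym (*-assoc _ _ _)) (trans (*-congʳ (*-comm _ _)) (*-assoc _ _ _)) ⟩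
    f (suc L) * (prod1To L (λ i → pow (f i) (g i)) * pow (f (suc L)) (g (suc L))) ∎
    where
    bumped = λ i → pow (f i) (if ⌊ i ≟ℕ suc L ⌋ then suc (g i) else g i)
  ... | no 1+L≢n with ℕₚ.m≤n⇒m<n∨m≡n n≤L
  ...   | inj₂ e          = ⊥-elim (1+L≢n (≡.sym e))
  ...   | inj₁ (s≤s n≤L′) = trans (*-congʳ (prod-bump L n f g 1≤n n≤L′)) (*-assoc _ _ _)

  weight-of-runs : ∀ L r → RunsBounded L r →
    prod1To L (λ i → pow (t i) (runCount U i r)) * prod1To L (λ i → pow (s i) (runCount H i r)) ≈ runListWeight r
  weight-of-runs L [] _ = trans (*-cong (prod-one L) (prod-one L)) (*-identityˡ _)
  weight-of-runs L ((U , n) ∷ r) (p , q , rest) =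
    trans (*-congʳ (prod-bump L n t (λ i → runCount U i r) p q))
          (trans (*-assoc _ _ _) (*-congˡ (weight-of-runs L r rest)))
  weight-of-runs L ((H , n) ∷ r) (p , q , rest) =
    trans (*-congˡ (prod-bump L n s (λ i → runCount H i r) p q))
          (trans (trans (sym (*-assoc _ _ _)) (trans (*-congʳ (*-comm _ _)) (*-assoc _ _ _))) (*-congˡ (weight-of-runs L r rest)))
  weight-of-runs L ((D , n) ∷ r) (p , q , rest) = trans (weight-of-runs L r rest) (sym (*-identityˡ _))

  weight≈runWeight : ∀ P → weight t s P ≈ runWeight P
  weight≈runWeight P =
    trans (*-cong (prod-cong (length P) (λ i _ _ → ≡⇒≈ (≡.cong (pow (t i)) (segCount≡runCount U i P))))
                  (prod-cong (length P) (λ i _ _ → ≡⇒≈ (≡.cong (pow (s i)) (segCount≡runCount H i P)))))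
          (trans (weight-of-runs (length P) (runs P) (runs-bounded P)) (sym (runWeight≈runListWeight P)))

  sum-filter : ∀ (g : List Step → Bool) (f : List Step → Carrier) L →
    sumList (map f (filter (λ P → Boolₚ.T? (g P)) L)) ≈ ΣL L (λ P → guard (g P) (f P))
  sum-filter g f []      = refl
  sum-filter g f (x ∷ L) with g x
  ... | true  = +-congˡ (sum-filter g f L)
  ... | false = trans (sum-filter g f L) (sym (+-identityˡ _))

  M≈paths : ∀ m k → Mser t s m k ≈ paths 0 anyPath m k
  M≈paths m k = trans (sum-filter _ (weight t s) (words (2 *ℕ m +ℕ k)))
    (Σw-cong (2 *ℕ m +ℕ k) (λ P → trans (guard-cong _ (weight≈runWeight P))
       (≡⇒≈ (≡.cong (λ z → guard z (runWeight P))
         (≡.cong₂ (λ u v → validFrom 0 P ∧ (u ∧ v)) (≡ᵇ-≟ (count U P) m) (≡ᵇ-≟ (count H P) k))))))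

-- Coefficients of (S(y) - 1)·X and (T(z) - 1)·X, matching the leading-run
-- decompositions: multiplying by s_l y^l, resp. t_l z^l = t_l x^l M^l.
module SeriesCoefficients {c ℓ : Level} (R : CommutativeRing c ℓ) (t s : ℕ → CommutativeRing.Carrier R) where
  open CommutativeRing R
  open Series R
  open FiniteSums R
  open Bivariate R
  open TimesX R
  open RingProperties ring using (-0#≈0#)
  open SetoidReasoning setoid

  S-1-times : ∀ X m k → ((Sser t s -₂ 1₂) *₂ X) m k ≈ sumBelow k (λ l → s (suc l) * X m (k ∸ suc l))
  S-1-times X m k = begin
    ((Sser t s -₂ 1₂) *₂ X) m k
      ≈⟨ mul-eval _ X m k ⟩
    sumTo m (λ i → sumTo k (λ j → (Sser t s -₂ 1₂) i j * X (m ∸ i) (k ∸ j)))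
      ≈⟨ sum-front m _ ⟩
    sumTo k (λ j → (Sser t s -₂ 1₂) 0 j * X m (k ∸ j)) +
      sumBelow m (λ i → sumTo k (λ j → (0# - 0#) * X (m ∸ suc i) (k ∸ j)))
      ≈⟨ +-cong (sum-front k _) (sum-zero m (λ i _ → sum-zero (suc k) (λ j _ → trans (*-congʳ (-‿inverseʳ 0#)) (zeroˡ _)))) ⟩
    ((1# - 1#) * X m k + sumBelow k (λ l → (s (suc l) - 0#) * X m (k ∸ suc l))) + 0#
      ≈⟨ trans (+-identityʳ _) (trans (+-congʳ (trans (*-congʳ (-‿inverseʳ 1#)) (zeroˡ _))) (+-identityˡ _)) ⟩
    sumBelow k (λ l → (s (suc l) - 0#) * X m (k ∸ suc l))
      ≈⟨ sum-cong k (λ l → *-congʳ (trans (+-congˡ -0#≈0#) (+-identityʳ _))) ⟩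
    sumBelow k (λ l → s (suc l) * X m (k ∸ suc l)) ∎

  M z T[z] : Ser
  M    = Mser t s
  z    = zser t s
  T[z] = Tz t s

  z≈xM : z ≈₂ timesX M
  z≈xM zero    k = refl
  z≈xM (suc m) k = refl

  z^-low : ∀ j a b → a < j → pw z j a b ≈ 0#
  z^-low j a b a<j = trans (pw-cong j z≈xM a b) (trans (pw-timesX M j a b) (timesX^-< j (pw M j) a b a<j))

  Tz-1-eval : ∀ a b → (T[z] -₂ 1₂) a b ≈ sumBelow a (λ i → t (suc i) * pw z (suc i) a b)
  Tz-1-eval a b = begin
    T[z] a b + - 1₂ a b
      ≈⟨ +-congʳ (trans (sum-cong (suc (a +ℕ b)) (λ i → *-congˡ (powS≈ z i a b))) (sum-front (a +ℕ b) _)) ⟩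
    (1# * 1₂ a b + Σz) + - 1₂ a b  ≈⟨ +-congʳ (+-congʳ (*-identityˡ _)) ⟩
    (1₂ a b + Σz) + - 1₂ a b       ≈⟨ +-congʳ (+-comm _ _) ⟩
    (Σz + 1₂ a b) + - 1₂ a b       ≈⟨ +-assoc _ _ _ ⟩
    Σz + (1₂ a b + - 1₂ a b)       ≈⟨ +-congˡ (-‿inverseʳ _) ⟩
    Σz + 0#                         ≈⟨ +-identityʳ _ ⟩
    Σz                              ≈⟨ sum-extend a (a +ℕ b) (m≤m+n a b)
                                         (λ i a≤i _ → trans (*-congˡ (z^-low (suc i) a b (s≤s a≤i))) (zeroʳ _)) ⟩
    sumBelow a (λ i → t (suc i) * pw z (suc i) a b) ∎
    where
    Σz = sumBelow (a +ℕ b) (λ i → t (suc i) * pw z (suc i) a b)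

  -- Σ_{l<m} t_{l+1} z^{l+1}, which agrees with T(z) - 1 in x-degrees ≤ m.
  Tz-1-upTo : ℕ → Ser
  Tz-1-upTo m = Σ₂.sumBelow m (λ l → scale (t (suc l)) (pw z (suc l)))

  Tz-1-upTo-eval : ∀ m a b → a ≤ m → Tz-1-upTo m a b ≈ sumBelow a (λ i → t (suc i) * pw z (suc i) a b)
  Tz-1-upTo-eval m a b a≤m = trans (≡⇒≈ (Σ₂-eval m _ a b))
    (sum-extend a m a≤m (λ i a≤i _ → trans (*-congˡ (z^-low (suc i) a b (s≤s a≤i))) (zeroʳ _)))

  Tz-1-times : ∀ X m k → ((T[z] -₂ 1₂) *₂ X) m k ≈ sumBelow m (λ l → t (suc l) * (pw M (suc l) *₂ X) (m ∸ suc l) k)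
  Tz-1-times X m k = begin
    ((T[z] -₂ 1₂) *₂ X) m k
      ≈⟨ *₂-comm (T[z] -₂ 1₂) X m k ⟩
    (X *₂ (T[z] -₂ 1₂)) m k
      ≈⟨ agree X _ (Tz-1-upTo m) m k (λ i j i≤m _ → trans (Tz-1-eval i j) (sym (Tz-1-upTo-eval m i j i≤m))) ⟩
    (X *₂ Tz-1-upTo m) m k
      ≈⟨ *₂-comm X (Tz-1-upTo m) m k ⟩
    (Tz-1-upTo m *₂ X) m k
      ≈⟨ FiniteSums₂.sum-*ʳ m X _ m k ⟩
    Σ₂.sumBelow m (λ l → scale (t (suc l)) (pw z (suc l)) *₂ X) m k
      ≈⟨ ≡⇒≈ (Σ₂-eval m _ m k) ⟩
    sumBelow m (λ l → (scale (t (suc l)) (pw z (suc l)) *₂ X) m k)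
      ≈⟨ sum-cong-< m (λ l l<m → trans (scale-*₂ _ _ X m k) (*-congˡ
            (trans (*₂-cong (pw-cong (suc l) z≈xM) (≈₂-refl {X}) m k)
            (trans (pw-timesX-*₂ M (suc l) X m k) (timesX^-≤ (suc l) _ m k l<m))))) ⟩
    sumBelow m (λ l → t (suc l) * (pw M (suc l) *₂ X) (m ∸ suc l) k) ∎

module Elimination {c ℓ : Level} (C : CommutativeRing c ℓ) where
  open CommutativeRing C
  open RingProperties ring using (-‿distribʳ-*; -1*x≈-x)
  open SetoidReasoning setoid

  x+[y-x]≈y : ∀ x y → x + (y - x) ≈ y
  x+[y-x]≈y x y = trans (+-congˡ (+-comm _ _)) (trans (sym (+-assoc _ _ _)) (trans (+-congʳ (-‿inverseʳ x)) (+-identityˡ y)))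

  x+[a-1]x≈ax : ∀ a x → x + (a - 1#) * x ≈ a * x
  x+[a-1]x≈ax a x = trans (+-congˡ (trans (distribʳ x a (- 1#)) (+-congˡ (-1*x≈-x x)))) (x+[y-x]≈y x (a * x))

  eliminate : ∀ P Pu Ph Nu Nh T S S⁻¹ →
    P ≈ 1# + (Pu + Ph) → Nu ≈ 1# + Ph → Nh ≈ 1# + Pu → Ph ≈ (S - 1#) * Nh → Pu ≈ (T - 1#) * Nu → S * S⁻¹ ≈ 1# →
    P * (1# - ((S - 1#) * S⁻¹) * T) ≈ T
  eliminate P Pu Ph Nu Nh T S S⁻¹ hP hNu hNh hPh hPu hS = begin
    P * (1# - ((S - 1#) * S⁻¹) * T)        ≈⟨ distribˡ P _ _ ⟩
    P * 1# + P * - (((S - 1#) * S⁻¹) * T)  ≈⟨ +-cong (*-identityʳ P) (sym (-‿distribʳ-* P _)) ⟩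
    P - P * (((S - 1#) * S⁻¹) * T)         ≈⟨ +-cong P≈T+Q (-‿cong reorder) ⟩
    (T + Q) - Q                            ≈⟨ trans (+-assoc _ _ _) (trans (+-congˡ (-‿inverseʳ Q)) (+-identityʳ T)) ⟩
    T                                      ∎
    where
    Q = T * (S⁻¹ * ((S - 1#) * P))
    reorder : P * (((S - 1#) * S⁻¹) * T) ≈ Q
    reorder = prove 4 (VP ⊕ ((VS ⊕ VI) ⊕ VT)) (VT ⊕ (VI ⊕ (VS ⊕ VP))) (P ∷ (S - 1#) ∷ S⁻¹ ∷ T ∷ [])
      where
      open import Data.Vec using (_∷_; [])
      open import Data.Fin using (#_)
      open CMSolver *-commutativeMonoid using (prove; var; _⊕_)
      VP = var (# 0); VS = var (# 1); VI = var (# 2); VT = var (# 3)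
    -- P = T Nu: the paths with a leading u contribute (T - 1) Nu, the others Nu.
    P≈T·Nu : P ≈ T * Nu
    P≈T·Nu = begin
      P                    ≈⟨ hP ⟩
      1# + (Pu + Ph)       ≈⟨ +-congˡ (+-comm _ _) ⟩
      1# + (Ph + Pu)       ≈⟨ sym (+-assoc _ _ _) ⟩
      (1# + Ph) + Pu       ≈⟨ +-cong (sym hNu) hPu ⟩
      Nu + (T - 1#) * Nu   ≈⟨ x+[a-1]x≈ax T Nu ⟩
      T * Nu               ∎
    S·Ph≈[S-1]P : S * Ph ≈ (S - 1#) * P
    S·Ph≈[S-1]P = begin
      S * Ph                         ≈⟨ sym (x+[a-1]x≈ax S Ph) ⟩
      Ph + (S - 1#) * Ph             ≈⟨ +-congʳ hPh ⟩
      (S - 1#) * Nh + (S - 1#) * Ph  ≈⟨ sym (distribˡ _ Nh Ph) ⟩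
      (S - 1#) * (Nh + Ph)           ≈⟨ *-congˡ (+-congʳ hNh) ⟩
      (S - 1#) * ((1# + Pu) + Ph)    ≈⟨ *-congˡ (trans (+-assoc _ _ _) (sym hP)) ⟩
      (S - 1#) * P                   ∎
    Ph≈S⁻¹[S-1]P : Ph ≈ S⁻¹ * ((S - 1#) * P)
    Ph≈S⁻¹[S-1]P = begin
      Ph                     ≈⟨ sym (*-identityˡ Ph) ⟩
      1# * Ph                ≈⟨ *-congʳ (trans (sym hS) (*-comm S S⁻¹)) ⟩
      (S⁻¹ * S) * Ph         ≈⟨ *-assoc _ _ _ ⟩
      S⁻¹ * (S * Ph)         ≈⟨ *-congˡ S·Ph≈[S-1]P ⟩
      S⁻¹ * ((S - 1#) * P)   ∎
    P≈T+Q : P ≈ T + Q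
    P≈T+Q = begin
      P                 ≈⟨ P≈T·Nu ⟩
      T * Nu            ≈⟨ *-congˡ hNu ⟩
      T * (1# + Ph)     ≈⟨ distribˡ T 1# Ph ⟩
      T * 1# + T * Ph   ≈⟨ +-cong (*-identityʳ T) (*-congˡ Ph≈S⁻¹[S-1]P) ⟩
      T + Q             ∎

module SeriesEquations {c ℓ : Level} (R : CommutativeRing c ℓ) (t s : ℕ → CommutativeRing.Carrier R) where
  open CommutativeRing R
  open Series R
  open FiniteSums R
  open Bivariate R
  open WordFacts
  open Families R t s
  open FirstStep R t s
  open WeightIsRunWeight R t s
  open SeriesCoefficients R t s
  open RingProperties ring using (-0#≈0#)

  P Pu Ph Nu Nh : Ser
  P  m k = paths 0 anyPath m k
  Pu m k = paths 0 (startsWith U) m k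
  Ph m k = paths 0 (startsWith H) m k
  Nu m k = paths 0 noLeadingU m k
  Nh m k = paths 0 noLeadingH m k

  M≈P : M ≈₂ P
  M≈P = M≈paths

  P-eq : P ≈₂ 1₂ +₂ (Pu +₂ Ph)
  P-eq m k = trans (M-firstLetter m k) (+-congʳ (oneS≈ m k))

  Nu-eq : Nu ≈₂ 1₂ +₂ Ph
  Nu-eq m k = trans (NU-firstLetter m k) (+-congʳ (oneS≈ m k))

  Nh-eq : Nh ≈₂ 1₂ +₂ Pu
  Nh-eq m k = trans (NH-firstLetter m k) (+-congʳ (oneS≈ m k))

  Ph-eq : Ph ≈₂ (Sser t s -₂ 1₂) *₂ Nh
  Ph-eq m k = trans (leadingH m k) (sym (S-1-times Nh m k))

  -- Walks from height h are h + 1 successive walks from height 0, glued by first descents.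
  fromHeight : ∀ h → (λ m k → paths h anyPath m k) ≈₂ pw P (suc h)
  fromHeight zero    m k = sym (*₂-identityʳ P m k)
  fromHeight (suc h) m k = trans (paths-firstDescent anyPath (λ _ _ → ≡.refl) h m k)
    (trans (sym (mul-eval P (λ m k → paths h anyPath m k) m k)) (*₂-cong (≈₂-refl {P}) (fromHeight h) m k))

  noLeadingU-prefix : ∀ A B → noLeadingU (A ++ D ∷ B) ≡ noLeadingU A
  noLeadingU-prefix []      B = ≡.refl
  noLeadingU-prefix (x ∷ A) B = ≡.refl

  noLeadingU-fromHeight : ∀ l → (λ m k → paths (suc l) noLeadingU m k) ≈₂ Nu *₂ pw P (suc l)
  noLeadingU-fromHeight l m k = trans (paths-firstDescent noLeadingU noLeadingU-prefix l m k)
    (trans (sym (mul-eval Nu (λ m k → paths l anyPath m k) m k)) (*₂-cong (≈₂-refl {Nu}) (fromHeight l) m k))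

  Pu-eq : Pu ≈₂ (Tz t s -₂ 1₂) *₂ Nu
  Pu-eq m k = trans (leadingU m k) (trans
    (sum-cong m (λ l → *-congˡ (trans (noLeadingU-fromHeight l (m ∸ suc l) k)
      (trans (*₂-comm Nu (pw P (suc l)) (m ∸ suc l) k)
             (*₂-cong (pw-cong (suc l) (≈₂-sym M≈P)) (≈₂-refl {Nu}) (m ∸ suc l) k)))))
    (sym (Tz-1-times Nu m k)))

  S-1/S denominator : Ser
  S-1/S       = (Sser t s -₂ 1₂) *₂ invS (Sser t s)
  denominator = 1₂ -₂ (S-1/S *₂ Tz t s)

  denominator-constant : denominator 0 0 ≈ 1#
  denominator-constant = trans (+-congˡ (-‿cong (trans (mul00 S-1/S (Tz t s))
    (trans (*-congʳ (trans (mul00 (Sser t s -₂ 1₂) (invS (Sser t s))) (trans (*-congʳ (-‿inverseʳ 1#)) (zeroˡ _))))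
           (zeroˡ _)))))
    (trans (+-congˡ -0#≈0#) (+-identityʳ 1#))

  rhs≈T[z]/denominator : rhs t s ≈₂ Tz t s *₂ invS denominator
  rhs≈T[z]/denominator = ≈₂-trans (mulS≈ (Tz t s) (invS argument))
    (*₂-cong (≈₂-refl {Tz t s}) (invS-cong {argument} {denominator} argument≈denominator))
    where
    argument = oneS -S (((Sser t s -S oneS) *S invS (Sser t s)) *S Tz t s)
    S-1/S≈ : ((Sser t s -S oneS) *S invS (Sser t s)) ≈₂ S-1/S
    S-1/S≈ = ≈₂-trans (mulS≈ (Sser t s -S oneS) (invS (Sser t s)))
      (*₂-cong {Sser t s -S oneS} {Sser t s -₂ 1₂} {invS (Sser t s)} {invS (Sser t s)}
               (λ a b → +-congˡ (-‿cong (oneS≈ a b))) ≈₂-refl)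
    argument≈denominator : argument ≈₂ denominator
    argument≈denominator m k = +-cong (oneS≈ m k) (-‿cong
      (≈₂-trans (mulS≈ ((Sser t s -S oneS) *S invS (Sser t s)) (Tz t s))
        (*₂-cong {_} {S-1/S} {Tz t s} {Tz t s} S-1/S≈ ≈₂-refl) m k))

proposition2p1 : {c ℓ : Level} (R : CommutativeRing c ℓ) (t s : ℕ → CommutativeRing.Carrier R) →
    (m k : ℕ) → CommutativeRing._≈_ R (Series.Mser R t s m k) (Series.rhs R t s m k)
proposition2p1 R t s = M≈rhs
  where
  open Series R using (Mser; Sser; Tz; rhs; invS)
  open Bivariate R
  open SeriesEquations R t s
  open SetoidReasoning (CommutativeRing.setoid R2)

  P·denominator≈T[z] : P *₂ denominator ≈₂ Tz t s
  P·denominator≈T[z] = Elimination.eliminate R2 P Pu Ph Nu Nh (Tz t s) (Sser t s) (invS (Sser t s))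
    P-eq Nu-eq Nh-eq Ph-eq Pu-eq (invS-inverse (Sser t s) (CommutativeRing.refl R))

  M≈rhs : Mser t s ≈₂ rhs t s
  M≈rhs = begin
    Mser t s                                  ≈⟨ M≈P ⟩
    P                                         ≈⟨ ≈₂-sym (*₂-identityʳ P) ⟩
    P *₂ 1₂                                   ≈⟨ *₂-cong (≈₂-refl {P}) (≈₂-sym (invS-inverse denominator denominator-constant)) ⟩
    P *₂ (denominator *₂ invS denominator)    ≈⟨ ≈₂-sym (*₂-assoc P denominator (invS denominator)) ⟩
    (P *₂ denominator) *₂ invS denominator    ≈⟨ *₂-cong P·denominator≈T[z] (≈₂-refl {invS denominator}) ⟩
    Tz t s *₂ invS denominator                ≈⟨ ≈₂-sym rhs≈T[z]/denominator ⟩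
    rhs t s                                   ∎
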